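{- Let $S$ be a set of positive integers with $1\in S$, and let $n,k,t$ be positive integers. Then \[\left[{n\atop k/t}\right]_S=\sum_{i=0}^t\sum_{j=0}^{k-1}\binom{n}{i,j}(k-1)_j\left[{n-i-j\atop k-j/t-i}\right]_{S\setminus\{1\}},\] where $\binom{n}{i,j}=\frac{n!}{i!\,j!\,(n-i-j)!}$ if $i+j\le n$ and $0$ otherwise, and $(k-1)_j=(k-1)(k-2)\cdots(k-j)$ is the falling factorial.
   Context: For a set $S$ of positive integers and integers $m\ge0$, $k\ge1$, $t\ge0$, $\left[{m\atop k/t}\right]_S$ denotes the number of permutations of $[m]=\{1,\ldots,m\}$ all of whose cycle lengths lie in $S$, together with a colouring of the cycles by colours from $\{1,\ldots,k\}$ such that exactly $t$ cycles receive colour $1$ (the special colour) and each of the colours $2,\ldots,k$ is used on exactly one cycle (for $m=0$ the count is $1$ if $t+k-1=0$, else $0$). -}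

module Defs where

open import Data.Nat using (ℕ; zero; suc; _+_; _*_; _∸_; _!; _/_; _≤ᵇ_; _≡ᵇ_; NonZero)
open import Data.Nat.Properties using (_!≢0; m*n≢0)
open import Data.Bool using (Bool; true; false; if_then_else_; _∧_; _∨_; not)
open import Data.Fin using (Fin; toℕ)
open import Data.Vec using (Vec; []; _∷_; lookup)
open import Data.List using (List; []; _∷_; map; concatMap; upTo; allFin)
open import Data.Bool.ListAction using (and; or)
open import Data.Nat.ListAction using (sum)

count : {A : Set} → (A → Bool) → List A → ℕ
count p []       = 0
count p (x ∷ xs) = if p x then suc (count p xs) else count p xs

allF : (m : ℕ) → (Fin m → Bool) → Bool
allF m p = and (map p (allFin m))

anyF : (m : ℕ) → (Fin m → Bool) → Bool
anyF m p = or (map p (allFin m))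

allBelow : (m : ℕ) → (ℕ → Bool) → Bool
allBelow m p = and (map p (upTo m))

_==_ : {m : ℕ} → Fin m → Fin m → Bool
x == y = toℕ x ≡ᵇ toℕ y

-- all vectors of length m with entries in Fin n, i.e. all functions [m] → [n]
allVecs : (n m : ℕ) → List (Vec (Fin n) m)
allVecs n zero    = [] ∷ []
allVecs n (suc m) = concatMap (λ v → map (λ a → a ∷ v) (allFin n)) (allVecs n m)

isPerm : (m : ℕ) → (Fin m → Fin m) → Bool
isPerm m σ = allF m (λ x → allF m (λ y → not (σ x == σ y) ∨ (x == y)))
           ∧ allF m (λ y → anyF m (λ x → σ x == y))

iter : {m : ℕ} → (Fin m → Fin m) → ℕ → Fin m → Fin m
iter σ zero    x = x
iter σ (suc p) x = σ (iter σ p x)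

-- least p with 1 ≤ p ≤ bound and σ^p x = x (returns 0 if none; for a
-- permutation of [m] with bound = m it is the length of the cycle of x)
cycLenFrom : {m : ℕ} → (Fin m → Fin m) → Fin m → ℕ → ℕ → ℕ
cycLenFrom σ x p zero          = 0
cycLenFrom σ x p (suc fuel)    =
  if iter σ p x == x then p else cycLenFrom σ x (suc p) fuel

cycLen : (m : ℕ) → (Fin m → Fin m) → Fin m → ℕ
cycLen m σ x = cycLenFrom σ x 1 m

-- x is the least element of its cycle (cycles are identified with these
-- representatives, so counting cycles = counting representatives)
isRep : (m : ℕ) → (Fin m → Fin m) → Fin m → Bool
isRep m σ x = allBelow m (λ p → toℕ x ≤ᵇ toℕ (iter σ p x))

-- Colours are Fin k; colour 'zero' (toℕ = 0) plays the role of the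
-- special colour 1 of the paper, colours 1..k-1 (toℕ) play colours 2..k.
-- A colouring of the cycles of σ is a map c : Fin m → Fin k constant on
-- cycles (c (σ x) = c x).

cyclesColoured : (m k : ℕ) → (Fin m → Fin m) → (Fin m → Fin k) → ℕ → ℕ
cyclesColoured m k σ c j =
  count (λ x → isRep m σ x ∧ (toℕ (c x) ≡ᵇ j)) (allFin m)

validPair : (S : ℕ → Bool) (m k t : ℕ) → Vec (Fin m) m → Vec (Fin k) m → Bool
validPair S m k t vσ vc =
  let σ = lookup vσ ; c = lookup vc in
      isPerm m σ
    ∧ allF m (λ x → S (cycLen m σ x))
    ∧ allF m (λ x → toℕ (c (σ x)) ≡ᵇ toℕ (c x))
    ∧ (cyclesColoured m k σ c 0 ≡ᵇ t)
    ∧ allF k (λ j → (toℕ j ≡ᵇ 0) ∨ (cyclesColoured m k σ c (toℕ j) ≡ᵇ 1))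

-- [ m  k / t ]_S : number of pairs (permutation with cycle lengths in S,
-- admissible colouring of its cycles)
cycNum : (S : ℕ → Bool) → (m k t : ℕ) → ℕ
cycNum S m k t =
  sum (map (λ vσ → count (validPair S m k t vσ) (allVecs k m)) (allVecs m m))

without1 : (ℕ → Bool) → (ℕ → Bool)
without1 S n = if n ≡ᵇ 1 then false else S n

multinom : ℕ → ℕ → ℕ → ℕ
multinom n i j =
  if i + j ≤ᵇ n
  then _/_ (n !) (i ! * j ! * (n ∸ i ∸ j) !)
           {{m*n≢0 (i ! * j !) ((n ∸ i ∸ j) !)
               {{m*n≢0 (i !) (j !) {{i !≢0}} {{j !≢0}}}} {{(n ∸ i ∸ j) !≢0}}}}
  else 0

fall : ℕ → ℕ → ℕ
fall x zero    = 1
fall x (suc j) = fall x j * (x ∸ j)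

sumTo : ℕ → (ℕ → ℕ) → ℕ
sumTo t f = sum (map f (upTo (suc t)))

module Submission where

-- Sort the coloured permutations by the number i of fixed points of the special colour and
-- the number j of fixed points of the other colours, and let N(m, t, i, j) count them.
-- Marking a special fixed point and deleting it (allowed since 1 ∈ S) gives
--   (i+1) N(m+1, t+1, i+1, j) = (m+1) N(m, t, i, j);
-- marking an ordinary fixed point, deleting it together with its colour (used by no other
-- cycle) and relabelling the remaining colours gives, with k+1 colours,
--   (j+1) N_{k+1}(m+1, t, i, j+1) = (m+1) k N_k(m, t, i, j).
-- As N(m, t, 0, 0) = [m, k/t]_{S∖{1}}, the recurrences are solved by
--   N_k(m, t, i, j) = (m choose i, j) (k-1)_j [m-i-j, k-j / t-i]_{S∖{1}}   (i ≤ t),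
-- and summing over i and j gives the theorem.

open import Defs
open import Data.Nat using (ℕ; zero; suc; _+_; _*_; _∸_; _≤_; _<_; _≤?_; z≤n; s≤s; _≡ᵇ_; _≤ᵇ_; NonZero; _!; _/_; _%_)
open import Data.Nat.Divisibility using (_∣_; ∣-trans; *-monoˡ-∣)
open import Data.Nat.Solver using (module +-*-Solver)
open import Data.Nat.Properties
open import Data.Bool using (Bool; true; false; if_then_else_; _∧_; _∨_; not; T)
open import Data.Bool.Properties using (∧-conicalˡ; ∧-conicalʳ; ∧-zeroʳ; ∧-identityʳ)
open import Data.Fin using (Fin; toℕ; punchIn; punchOut) renaming (zero to fz; suc to fs)
import Data.Fin.Properties as Fin
open import Data.Vec using (Vec; []; _∷_; lookup; insertAt)
import Data.Vec as Vec
import Data.Vec.Properties as Vec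
open import Data.List using (List; []; _∷_; map; concatMap; allFin; tabulate; upTo; applyUpTo; _++_)
import Data.List.Properties as List
open import Data.Nat.ListAction.Properties using (sum-++)
open import Data.Nat.DivMod using (m≡m%n+[m/n]*n; m%n<n; m/n*n≡m)
open import Data.Nat.Combinatorics.Specification using ([n∸k]!k!∣n!)
open import Data.Nat.ListAction using (sum)
open import Data.Bool.ListAction using (and; or)
open import Data.Product using (Σ; _×_; _,_; proj₁; proj₂)
open import Data.Sum using (_⊎_; inj₁; inj₂)
open import Data.Empty using (⊥; ⊥-elim)
open import Relation.Nullary using (yes; no; contradiction)
open import Relation.Binary.PropositionalEquality
open import Function using (_∘_; id)
open import Function.Definitions using (Injective)
open import Algebra.Properties.Semiring.Sum +-*-semiring
  using (sum-syntax; sum-remove; ∑-comm; *-distribˡ-sum; sum-cong-≗; sum-replicate-zero)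
  renaming (sum to ∑)

ind : Bool → ℕ
ind b = if b then 1 else 0

ind-∧ : ∀ a b → ind (a ∧ b) ≡ ind a * ind b
ind-∧ true  b = sym (+-identityʳ (ind b))
ind-∧ false b = refl

ind-false : ∀ {b} → b ≡ false → ind b ≡ 0
ind-false refl = refl

Bool-ext : ∀ {a b} → (a ≡ true → b ≡ true) → (b ≡ true → a ≡ true) → a ≡ b
Bool-ext {true}  {true}  _ _ = refl
Bool-ext {true}  {false} f _ = sym (f refl)
Bool-ext {false} {true}  _ g = g refl
Bool-ext {false} {false} _ _ = refl

∧-intro : ∀ {a b} → a ≡ true → b ≡ true → a ∧ b ≡ true
∧-intro refl refl = refl

≡ᵇ-sound : ∀ {a b} → (a ≡ᵇ b) ≡ true → a ≡ b
≡ᵇ-sound {a} {b} e = ≡ᵇ⇒≡ a b (subst T (sym e) _)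

≡ᵇ-complete : ∀ {a b} → a ≡ b → (a ≡ᵇ b) ≡ true
≡ᵇ-complete {a} refl with a ≡ᵇ a | ≡⇒≡ᵇ a a refl
... | true | _ = refl

≡ᵇ-false : ∀ {a b} → a ≢ b → (a ≡ᵇ b) ≡ false
≡ᵇ-false {a} {b} a≢b with a ≡ᵇ b in eq
... | true  = ⊥-elim (a≢b (≡ᵇ-sound eq))
... | false = refl

≤ᵇ-sound : ∀ {a b} → (a ≤ᵇ b) ≡ true → a ≤ b
≤ᵇ-sound {a} {b} e = ≤ᵇ⇒≤ a b (subst T (sym e) _)

≤ᵇ-complete : ∀ {a b} → a ≤ b → (a ≤ᵇ b) ≡ true
≤ᵇ-complete {a} {b} a≤b with a ≤ᵇ b | ≤⇒≤ᵇ a≤b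
... | true | _ = refl

≤ᵇ-false : ∀ {a b} → b < a → (a ≤ᵇ b) ≡ false
≤ᵇ-false {a} {b} b<a with a ≤ᵇ b in eq
... | true  = ⊥-elim (<⇒≱ b<a (≤ᵇ-sound eq))
... | false = refl

≤ᵇ-false⇒> : ∀ {a b} → (a ≤ᵇ b) ≡ false → b < a
≤ᵇ-false⇒> {a} {b} e with ≤-<-connex a b
... | inj₁ a≤b = ⊥-elim (subst (λ x → x ≡ false → _) (sym (≤ᵇ-complete a≤b)) (λ ()) e)
... | inj₂ b<a = b<a

==-sound : ∀ {m} {a b : Fin m} → (a == b) ≡ true → a ≡ b
==-sound e = Fin.toℕ-injective (≡ᵇ-sound e)

==-complete : ∀ {m} {a b : Fin m} → a ≡ b → (a == b) ≡ true
==-complete e = ≡ᵇ-complete (cong toℕ e)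

==-false : ∀ {m} {a b : Fin m} → a ≢ b → (a == b) ≡ false
==-false a≢b = ≡ᵇ-false (a≢b ∘ Fin.toℕ-injective)

==-punchIn : ∀ {n} (x : Fin (suc n)) (a b : Fin n) → (punchIn x a == punchIn x b) ≡ (a == b)
==-punchIn x a b = Bool-ext (==-complete ∘ Fin.punchIn-injective x a b ∘ ==-sound)
                            (==-complete ∘ cong (punchIn x) ∘ ==-sound)

and-tabulate⁻ : ∀ {A : Set} n (g : Fin n → A) (p : A → Bool) →
  and (map p (tabulate g)) ≡ true → ∀ i → p (g i) ≡ true
and-tabulate⁻ (suc n) g p e fz     = ∧-conicalˡ _ _ e
and-tabulate⁻ (suc n) g p e (fs i) = and-tabulate⁻ n (g ∘ fs) p (∧-conicalʳ _ _ e) i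

and-tabulate⁺ : ∀ {A : Set} n (g : Fin n → A) (p : A → Bool) →
  (∀ i → p (g i) ≡ true) → and (map p (tabulate g)) ≡ true
and-tabulate⁺ zero    g p h = refl
and-tabulate⁺ (suc n) g p h = ∧-intro (h fz) (and-tabulate⁺ n (g ∘ fs) p (h ∘ fs))

or-tabulate⁻ : ∀ {A : Set} n (g : Fin n → A) (p : A → Bool) →
  or (map p (tabulate g)) ≡ true → Σ (Fin n) λ i → p (g i) ≡ true
or-tabulate⁻ (suc n) g p e with p (g fz) in eq
... | true  = fz , eq
... | false = let (i , h) = or-tabulate⁻ n (g ∘ fs) p e in fs i , h

or-tabulate⁺ : ∀ {A : Set} n (g : Fin n → A) (p : A → Bool) (i : Fin n) →
  p (g i) ≡ true → or (map p (tabulate g)) ≡ true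
or-tabulate⁺ (suc n) g p fz     h rewrite h = refl
or-tabulate⁺ (suc n) g p (fs i) h with p (g fz)
... | true  = refl
... | false = or-tabulate⁺ n (g ∘ fs) p i h

allF⁻ : ∀ {m} {p : Fin m → Bool} → allF m p ≡ true → ∀ i → p i ≡ true
allF⁻ {m} {p} = and-tabulate⁻ m id p

allF⁺ : ∀ {m} {p : Fin m → Bool} → (∀ i → p i ≡ true) → allF m p ≡ true
allF⁺ {m} {p} = and-tabulate⁺ m id p

anyF⁻ : ∀ {m} {p : Fin m → Bool} → anyF m p ≡ true → Σ (Fin m) λ i → p i ≡ true
anyF⁻ {m} {p} = or-tabulate⁻ m id p

anyF⁺ : ∀ {m} {p : Fin m → Bool} (i : Fin m) → p i ≡ true → anyF m p ≡ true
anyF⁺ {m} {p} = or-tabulate⁺ m id p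

allF-cong : ∀ m {p q : Fin m → Bool} → (∀ i → p i ≡ q i) → allF m p ≡ allF m q
allF-cong m e = cong and (List.map-cong e (allFin m))

allF-∧ : ∀ m (p q : Fin m → Bool) → allF m (λ z → p z ∧ q z) ≡ allF m p ∧ allF m q
allF-∧ m p q = Bool-ext
  (λ e → ∧-intro (allF⁺ (λ z → ∧-conicalˡ _ _ (allF⁻ {p = pq} e z)))
                 (allF⁺ (λ z → ∧-conicalʳ _ _ (allF⁻ {p = pq} e z))))
  (λ e → allF⁺ {p = pq} (λ z → ∧-intro (allF⁻ (∧-conicalˡ _ _ e) z) (allF⁻ (∧-conicalʳ (allF m p) _ e) z)))
  where
  pq : Fin m → Bool
  pq z = p z ∧ q z

allF-punchIn : ∀ {m} (x : Fin (suc m)) (p : Fin (suc m) → Bool) →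
  allF (suc m) p ≡ p x ∧ allF m (p ∘ punchIn x)
allF-punchIn {m} x p = Bool-ext
  (λ e → ∧-intro (allF⁻ e x) (allF⁺ (allF⁻ e ∘ punchIn x)))
  (λ e → allF⁺ (λ z → split e z (z Fin.≟ x)))
  where
  split : p x ∧ allF m (p ∘ punchIn x) ≡ true → ∀ z → _ → p z ≡ true
  split e z (yes refl) = ∧-conicalˡ _ _ e
  split e z (no z≢x)   = subst (λ w → p w ≡ true) (Fin.punchIn-punchOut (z≢x ∘ sym))
                           (allF⁻ (∧-conicalʳ _ _ e) (punchOut (z≢x ∘ sym)))

and-applyUpTo⁻ : ∀ n (g : ℕ → ℕ) (p : ℕ → Bool) →
  and (map p (applyUpTo g n)) ≡ true → ∀ q → q < n → p (g q) ≡ true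
and-applyUpTo⁻ (suc n) g p e zero    _         = ∧-conicalˡ _ _ e
and-applyUpTo⁻ (suc n) g p e (suc q) (s≤s q<n) = and-applyUpTo⁻ n (g ∘ suc) p (∧-conicalʳ _ _ e) q q<n

and-applyUpTo⁺ : ∀ n (g : ℕ → ℕ) (p : ℕ → Bool) →
  (∀ q → q < n → p (g q) ≡ true) → and (map p (applyUpTo g n)) ≡ true
and-applyUpTo⁺ zero    g p h = refl
and-applyUpTo⁺ (suc n) g p h =
  ∧-intro (h 0 (s≤s z≤n)) (and-applyUpTo⁺ n (g ∘ suc) p (λ q q<n → h (suc q) (s≤s q<n)))

and-applyUpTo-false : ∀ n (g : ℕ → ℕ) (p : ℕ → Bool) →
  and (map p (applyUpTo g n)) ≡ false → Σ ℕ λ q → q < n × p (g q) ≡ false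
and-applyUpTo-false (suc n) g p e with p (g 0) in eq
... | false = 0 , s≤s z≤n , eq
... | true  = let (q , q<n , h) = and-applyUpTo-false n (g ∘ suc) p e in suc q , s≤s q<n , h

allBelow⁻ : ∀ {m} {p : ℕ → Bool} → allBelow m p ≡ true → ∀ q → q < m → p q ≡ true
allBelow⁻ {m} {p} = and-applyUpTo⁻ m id p

allBelow⁺ : ∀ {m} {p : ℕ → Bool} → (∀ q → q < m → p q ≡ true) → allBelow m p ≡ true
allBelow⁺ {m} {p} = and-applyUpTo⁺ m id p

allBelow-false : ∀ {m} {p : ℕ → Bool} → allBelow m p ≡ false → Σ ℕ λ q → q < m × p q ≡ false
allBelow-false {m} {p} = and-applyUpTo-false m id p

allBelow-cong : ∀ m {p q : ℕ → Bool} → (∀ i → p i ≡ q i) → allBelow m p ≡ allBelow m q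
allBelow-cong m e = cong and (List.map-cong e (upTo m))

∑ₗ : {A : Set} → List A → (A → ℕ) → ℕ
∑ₗ xs f = sum (map f xs)

count≡∑ₗ : {A : Set} (p : A → Bool) (xs : List A) → count p xs ≡ ∑ₗ xs (ind ∘ p)
count≡∑ₗ p []       = refl
count≡∑ₗ p (x ∷ xs) with p x
... | true  = cong suc (count≡∑ₗ p xs)
... | false = count≡∑ₗ p xs

count-cong : {A : Set} {p q : A → Bool} (xs : List A) → (∀ x → p x ≡ q x) → count p xs ≡ count q xs
count-cong []       p≗q = refl
count-cong (x ∷ xs) p≗q rewrite p≗q x = cong (λ n → if _ then suc n else n) (count-cong xs p≗q)

∑ₗ-++ : {A : Set} (xs ys : List A) (f : A → ℕ) → ∑ₗ (xs ++ ys) f ≡ ∑ₗ xs f + ∑ₗ ys f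
∑ₗ-++ xs ys f = trans (cong sum (List.map-++ f xs ys)) (sum-++ (map f xs) (map f ys))

∑ₗ-concatMap : {A B : Set} (g : A → List B) (xs : List A) (f : B → ℕ) →
  ∑ₗ (concatMap g xs) f ≡ ∑ₗ xs (λ a → ∑ₗ (g a) f)
∑ₗ-concatMap g []       f = refl
∑ₗ-concatMap g (x ∷ xs) f = trans (∑ₗ-++ (g x) (concatMap g xs) f) (cong (∑ₗ (g x) f +_) (∑ₗ-concatMap g xs f))

∑ₗ-tabulate : ∀ {A : Set} n (g : Fin n → A) (f : A → ℕ) → ∑ₗ (tabulate g) f ≡ ∑[ i < n ] f (g i)
∑ₗ-tabulate zero    g f = refl
∑ₗ-tabulate (suc n) g f = cong (f (g fz) +_) (∑ₗ-tabulate n (g ∘ fs) f)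

∑ₗ-map : {A B : Set} (g : A → B) (xs : List A) (f : B → ℕ) → ∑ₗ (map g xs) f ≡ ∑ₗ xs (f ∘ g)
∑ₗ-map g xs f = cong sum (sym (List.map-∘ xs))

∑-zero : ∀ n (f : Fin n → ℕ) → (∀ i → f i ≡ 0) → ∑[ i < n ] f i ≡ 0
∑-zero n f f≡0 = trans (sum-cong-≗ f≡0) (sum-replicate-zero n)

∑-const : ∀ n a → ∑[ i < n ] a ≡ n * a
∑-const zero    a = refl
∑-const (suc n) a = cong (a +_) (∑-const n a)

count≡∑ : ∀ m (p : Fin m → Bool) → count p (allFin m) ≡ ∑[ i < m ] ind (p i)
count≡∑ m p = trans (count≡∑ₗ p (allFin m)) (∑ₗ-tabulate m id (ind ∘ p))

∑-ind≤ : ∀ n (p : Fin n → Bool) → ∑[ i < n ] ind (p i) ≤ n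
∑-ind≤ zero    p = z≤n
∑-ind≤ (suc n) p = +-mono-≤ (ind≤1 (p fz)) (∑-ind≤ n (p ∘ fs))
  where
  ind≤1 : ∀ b → ind b ≤ 1
  ind≤1 true  = s≤s z≤n
  ind≤1 false = z≤n

∑-ind≥1 : ∀ n (p : Fin n → Bool) (i : Fin n) → p i ≡ true → 1 ≤ ∑[ i < n ] ind (p i)
∑-ind≥1 (suc n) p fz     e rewrite e = s≤s z≤n
∑-ind≥1 (suc n) p (fs i) e = ≤-trans (∑-ind≥1 n (p ∘ fs) i e) (m≤n+m _ (ind (p fz)))

∑-ind≡0⁻ : ∀ n (p : Fin n → Bool) → ∑[ i < n ] ind (p i) ≡ 0 → ∀ i → p i ≡ false
∑-ind≡0⁻ (suc n) p e i with p fz in eq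
∑-ind≡0⁻ (suc n) p e fz     | false = eq
∑-ind≡0⁻ (suc n) p e (fs i) | false = ∑-ind≡0⁻ n (p ∘ fs) e i

∑-ind≡0⁺ : ∀ n (p : Fin n → Bool) → (∀ i → p i ≡ false) → ∑[ i < n ] ind (p i) ≡ 0
∑-ind≡0⁺ n p h = ∑-zero n (ind ∘ p) (ind-false ∘ h)

∑ᵥ : (n m : ℕ) → (Vec (Fin n) m → ℕ) → ℕ
∑ᵥ n zero    f = f []
∑ᵥ n (suc m) f = ∑ᵥ n m (λ v → ∑[ a < n ] f (a ∷ v))

∑ₗ-allVecs : ∀ n m (f : Vec (Fin n) m → ℕ) → ∑ₗ (allVecs n m) f ≡ ∑ᵥ n m f
∑ₗ-allVecs n zero    f = +-identityʳ (f [])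
∑ₗ-allVecs n (suc m) f = begin
  ∑ₗ (allVecs n (suc m)) f                              ≡⟨ ∑ₗ-concatMap _ (allVecs n m) f ⟩
  ∑ₗ (allVecs n m) (λ v → ∑ₗ (map (_∷ v) (allFin n)) f) ≡⟨ cong sum (List.map-cong inner (allVecs n m)) ⟩
  ∑ₗ (allVecs n m) (λ v → ∑[ a < n ] f (a ∷ v))        ≡⟨ ∑ₗ-allVecs n m _ ⟩
  ∑ᵥ n (suc m) f                                        ∎
  where
  open ≡-Reasoning
  inner : ∀ v → ∑ₗ (map (_∷ v) (allFin n)) f ≡ ∑[ a < n ] f (a ∷ v)
  inner v = trans (∑ₗ-map (_∷ v) (allFin n) f) (∑ₗ-tabulate n id (f ∘ (_∷ v)))

∑ᵥ-cong : ∀ n m {f g : Vec (Fin n) m → ℕ} → (∀ v → f v ≡ g v) → ∑ᵥ n m f ≡ ∑ᵥ n m g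
∑ᵥ-cong n zero    f≗g = f≗g []
∑ᵥ-cong n (suc m) f≗g = ∑ᵥ-cong n m (λ v → sum-cong-≗ (λ a → f≗g (a ∷ v)))

∑ᵥ-zero : ∀ n m (f : Vec (Fin n) m → ℕ) → (∀ v → f v ≡ 0) → ∑ᵥ n m f ≡ 0
∑ᵥ-zero n zero    f f≡0 = f≡0 []
∑ᵥ-zero n (suc m) f f≡0 = ∑ᵥ-zero n m _ (λ v → ∑-zero n _ (λ a → f≡0 (a ∷ v)))

*-distribˡ-∑ᵥ : ∀ n m a (f : Vec (Fin n) m → ℕ) → a * ∑ᵥ n m f ≡ ∑ᵥ n m (λ v → a * f v)
*-distribˡ-∑ᵥ n zero    a f = refl
*-distribˡ-∑ᵥ n (suc m) a f =
  trans (*-distribˡ-∑ᵥ n m a _) (∑ᵥ-cong n m (λ v → *-distribˡ-sum a (λ b → f (b ∷ v))))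

∑ᵥ-comm-∑ : ∀ n m k (f : Vec (Fin n) m → Fin k → ℕ) →
  ∑ᵥ n m (λ v → ∑[ x < k ] f v x) ≡ ∑[ x < k ] ∑ᵥ n m (λ v → f v x)
∑ᵥ-comm-∑ n zero    k f = refl
∑ᵥ-comm-∑ n (suc m) k f =
  trans (∑ᵥ-cong n m (λ v → ∑-comm (λ a x → f (a ∷ v) x)))
        (∑ᵥ-comm-∑ n m k (λ v x → ∑[ a < n ] f (a ∷ v) x))

∑ᵥ-insertAt : ∀ n m (x : Fin (suc m)) (f : Vec (Fin n) (suc m) → ℕ) →
  ∑ᵥ n (suc m) f ≡ ∑[ a < n ] ∑ᵥ n m (λ v → f (insertAt v x a))
∑ᵥ-insertAt n m       fz     f = ∑ᵥ-comm-∑ n m n (λ v a → f (a ∷ v))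
∑ᵥ-insertAt n (suc m) (fs x) f = ∑ᵥ-insertAt n m x (λ w → ∑[ b < n ] f (b ∷ w))

∑ᵥ-avoid : ∀ n m (x : Fin (suc n)) (f : Vec (Fin (suc n)) m → ℕ) →
  (∀ v i → lookup v i ≡ x → f v ≡ 0) →
  ∑ᵥ (suc n) m f ≡ ∑ᵥ n m (λ v → f (Vec.map (punchIn x) v))
∑ᵥ-avoid n zero    x f f≡0 = refl
∑ᵥ-avoid n (suc m) x f f≡0 =
  trans (∑ᵥ-cong (suc n) m (λ v → trans (sum-remove {i = x} (λ a → f (a ∷ v)))
                                         (cong (_+ ∑[ a < n ] f (punchIn x a ∷ v)) (f≡0 (x ∷ v) fz refl))))
        (∑ᵥ-avoid n m x _ (λ v i e → ∑-zero n _ (λ a → f≡0 (punchIn x a ∷ v) (fs i) e)))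

Surjective : ∀ {m} → (Fin m → Fin m) → Set
Surjective {m} σ = (b : Fin m) → Σ (Fin m) λ a → σ a ≡ b

isPerm⇒injective : ∀ {m} {σ : Fin m → Fin m} → isPerm m σ ≡ true → Injective _≡_ _≡_ σ
isPerm⇒injective {σ = σ} e {a} {b} σa≡σb with allF⁻ (allF⁻ (∧-conicalˡ _ _ e) a) b
... | h rewrite σa≡σb | ==-complete (refl {x = σ b}) = ==-sound h

isPerm⇒surjective : ∀ {m} {σ : Fin m → Fin m} → isPerm m σ ≡ true → Surjective σ
isPerm⇒surjective e b = let (a , h) = anyF⁻ (allF⁻ (∧-conicalʳ _ _ e) b) in a , ==-sound h

isPerm-intro : ∀ {m} {σ : Fin m → Fin m} → Injective _≡_ _≡_ σ → Surjective σ → isPerm m σ ≡ true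
isPerm-intro {σ = σ} inj surj =
  ∧-intro (allF⁺ (λ a → allF⁺ (λ b → injectiveᵇ a b)))
          (allF⁺ (λ b → let (a , h) = surj b in anyF⁺ a (==-complete h)))
  where
  injectiveᵇ : ∀ a b → (not (σ a == σ b) ∨ (a == b)) ≡ true
  injectiveᵇ a b with σ a == σ b in eq
  ... | false = refl
  ... | true  = ==-complete (inj (==-sound eq))

module _ {m : ℕ} (σ : Fin m → Fin m) where

  iter-+ : ∀ a b y → iter σ (a + b) y ≡ iter σ a (iter σ b y)
  iter-+ zero    b y = refl
  iter-+ (suc a) b y = cong σ (iter-+ a b y)

  iter-injective : Injective _≡_ _≡_ σ → ∀ p → Injective _≡_ _≡_ (iter σ p)
  iter-injective inj zero    e = e
  iter-injective inj (suc p) e = iter-injective inj p (inj e)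

  iter-invariant : ∀ {B : Set} (c : Fin m → B) → (∀ z → c (σ z) ≡ c z) → ∀ p y → c (iter σ p y) ≡ c y
  iter-invariant c inv zero    y = refl
  iter-invariant c inv (suc p) y = trans (inv _) (iter-invariant c inv p y)

  iter-fixedPoint : ∀ x → σ x ≡ x → ∀ p → iter σ p x ≡ x
  iter-fixedPoint x σx≡x zero    = refl
  iter-fixedPoint x σx≡x (suc p) = trans (cong σ (iter-fixedPoint x σx≡x p)) σx≡x

  -- Pigeonhole on y, σ y, …, σᵐ y.
  period : Injective _≡_ _≡_ σ → ∀ y → Σ ℕ λ L → 1 ≤ L × L ≤ m × iter σ L y ≡ y
  period inj y with Fin.pigeonhole (n<1+n m) (λ (q : Fin (suc m)) → iter σ (toℕ q) y)
  ... | i , j , i<j , eq = d , m<n⇒0<n∸m i<j , d≤m , iter-injective inj (toℕ i) eq′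
    where
    d = toℕ j ∸ toℕ i
    d≤m : d ≤ m
    d≤m = ≤-trans (m∸n≤m (toℕ j) (toℕ i)) (≤-pred (Fin.toℕ<n j))
    eq′ : iter σ (toℕ i) (iter σ d y) ≡ iter σ (toℕ i) y
    eq′ = trans (sym (iter-+ (toℕ i) d y))
                (trans (cong (λ z → iter σ z y) (m+[n∸m]≡n (<⇒≤ i<j))) (sym eq))

  iter-period-* : ∀ L y → iter σ L y ≡ y → ∀ n → iter σ (n * L) y ≡ y
  iter-period-* L y h zero    = refl
  iter-period-* L y h (suc n) = trans (iter-+ L (n * L) y) (trans (cong (iter σ L) (iter-period-* L y h n)) h)

  iter-period-% : ∀ L .{{_ : NonZero L}} y → iter σ L y ≡ y → ∀ q → iter σ q y ≡ iter σ (q % L) y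
  iter-period-% L y h q = trans (cong (λ z → iter σ z y) (m≡m%n+[m/n]*n q L))
    (trans (iter-+ (q % L) ((q / L) * L) y) (cong (iter σ (q % L)) (iter-period-* L y h (q / L))))

  cycLenFrom-fuel : ∀ y f e q r → q ≤ r → r < q + f → iter σ r y ≡ y →
    cycLenFrom σ y q (f + e) ≡ cycLenFrom σ y q f
  cycLenFrom-fuel y zero    e q r q≤r r<q _ =
    ⊥-elim (<-irrefl refl (≤-<-trans q≤r (subst (r <_) (+-identityʳ q) r<q)))
  cycLenFrom-fuel y (suc f) e q r q≤r r<q+f σʳy≡y with iter σ q y == y in eq
  ... | true  = refl
  ... | false = cycLenFrom-fuel y f e (suc q) r (≤∧≢⇒< q≤r q≢r) (subst (r <_) (+-suc q f) r<q+f) σʳy≡y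
    where
    q≢r : q ≢ r
    q≢r refl = subst (λ b → b ≡ false → ⊥) (sym (==-complete σʳy≡y)) (λ ()) eq

  cycLenFrom-zero-or-≥ : ∀ y q f → cycLenFrom σ y q f ≡ 0 ⊎ q ≤ cycLenFrom σ y q f
  cycLenFrom-zero-or-≥ y q zero = inj₁ refl
  cycLenFrom-zero-or-≥ y q (suc f) with iter σ q y == y
  ... | true  = inj₂ ≤-refl
  ... | false with cycLenFrom-zero-or-≥ y (suc q) f
  ...   | inj₁ e = inj₁ e
  ...   | inj₂ le = inj₂ (≤-trans (n≤1+n q) le)

  isRep-fixedPoint : ∀ x → σ x ≡ x → isRep m σ x ≡ true
  isRep-fixedPoint x σx≡x = allBelow⁺ {m} λ q _ →
    subst (λ w → (toℕ x ≤ᵇ toℕ w) ≡ true) (sym (iter-fixedPoint x σx≡x q)) (≤ᵇ-complete (≤-refl {toℕ x}))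

  -- Walk along the orbit of y, always jumping to a strictly smaller element, until a representative is reached.
  orbit-has-rep : ∀ y → Σ ℕ λ n → isRep m σ (iter σ n y) ≡ true
  orbit-has-rep y = go (suc (toℕ y)) 0 ≤-refl
    where
    go : ∀ b n → toℕ (iter σ n y) < b → Σ ℕ λ n → isRep m σ (iter σ n y) ≡ true
    go (suc b) n lt with isRep m σ (iter σ n y) in eq
    ... | true  = n , eq
    ... | false =
      let (p , _ , h) = allBelow-false {m} eq
          lt′ : toℕ (iter σ (p + n) y) < b
          lt′ = subst (λ w → toℕ w < b) (sym (iter-+ p n y)) (<-≤-trans (≤ᵇ-false⇒> h) (≤-pred lt))
      in go b (p + n) lt′

cycLen≡ᵇ1 : ∀ {m} (σ : Fin (suc m) → Fin (suc m)) z → (cycLen (suc m) σ z ≡ᵇ 1) ≡ (σ z == z)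
cycLen≡ᵇ1 {m} σ z with σ z == z
... | true  = refl
... | false with cycLenFrom-zero-or-≥ σ z 2 m
...   | inj₁ e rewrite e = refl
...   | inj₂ le = ≡ᵇ-false (λ e → <-irrefl (sym e) le)

-- validPair S m k t vσ vc reduces to Valid S m k t (lookup vσ) (lookup vc).
Valid : (S : ℕ → Bool) (m k t : ℕ) → (Fin m → Fin m) → (Fin m → Fin k) → Bool
Valid S m k t σ c =
    isPerm m σ
  ∧ allF m (λ x → S (cycLen m σ x))
  ∧ allF m (λ x → toℕ (c (σ x)) ≡ᵇ toℕ (c x))
  ∧ (cyclesColoured m k σ c 0 ≡ᵇ t)
  ∧ allF k (λ j → (toℕ j ≡ᵇ 0) ∨ (cyclesColoured m k σ c (toℕ j) ≡ᵇ 1))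

specialFixed : ∀ m {k} → (Fin m → Fin m) → (Fin m → Fin k) → ℕ
specialFixed m σ c = count (λ z → (σ z == z) ∧ (toℕ (c z) ≡ᵇ 0)) (allFin m)

ordinaryFixed : ∀ m {k} → (Fin m → Fin m) → (Fin m → Fin k) → ℕ
ordinaryFixed m σ c = count (λ z → (σ z == z) ∧ not (toℕ (c z) ≡ᵇ 0)) (allFin m)

module _ {m k : ℕ} (S : ℕ → Bool) (t : ℕ) (σ : Fin m → Fin m) (c : Fin m → Fin k)
         (valid : Valid S m k t σ c ≡ true) where

  private
    rest₁ = ∧-conicalʳ (isPerm m σ) _ valid
    rest₂ = ∧-conicalʳ (allF m (λ x → S (cycLen m σ x))) _ rest₁
    rest₃ = ∧-conicalʳ (allF m (λ x → toℕ (c (σ x)) ≡ᵇ toℕ (c x))) _ rest₂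

  Valid⇒injective : Injective _≡_ _≡_ σ
  Valid⇒injective = isPerm⇒injective (∧-conicalˡ _ _ valid)

  Valid⇒colourInvariant : ∀ z → c (σ z) ≡ c z
  Valid⇒colourInvariant z = Fin.toℕ-injective (≡ᵇ-sound (allF⁻ (∧-conicalˡ _ _ rest₂) z))

  Valid⇒specialCycles : cyclesColoured m k σ c 0 ≡ t
  Valid⇒specialCycles = ≡ᵇ-sound (∧-conicalˡ _ _ rest₃)

  Valid⇒onceColoured : ∀ j → (toℕ j ≡ᵇ 0) ≡ false → cyclesColoured m k σ c (toℕ j) ≡ 1
  Valid⇒onceColoured j j≢0 = ≡ᵇ-sound {b = 1} (subst (λ b → b ∨ (cyclesColoured m k σ c (toℕ j) ≡ᵇ 1) ≡ true) j≢0
    (allF⁻ {k} {p = λ j → (toℕ j ≡ᵇ 0) ∨ (cyclesColoured m k σ c (toℕ j) ≡ᵇ 1)}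
           (∧-conicalʳ (cyclesColoured m k σ c 0 ≡ᵇ t) _ rest₃) j))

Valid-nonInjective : ∀ S m k t (σ : Fin m → Fin m) (c : Fin m → Fin k) a b →
  σ a ≡ σ b → a ≢ b → Valid S m k t σ c ≡ false
Valid-nonInjective S m k t σ c a b σa≡σb a≢b with Valid S m k t σ c in valid
... | true  = ⊥-elim (a≢b (Valid⇒injective S t σ c valid σa≡σb))
... | false = refl

-- The cycle of y contains a representative r ≢ x of the same colour as the fixed point x.
cyclesColoured-≥2 : ∀ {m K} (σ : Fin (suc m) → Fin (suc m)) (c : Fin (suc m) → Fin K) x y →
  Injective _≡_ _≡_ σ → (∀ z → c (σ z) ≡ c z) → σ x ≡ x → y ≢ x → c y ≡ c x →
  2 ≤ cyclesColoured (suc m) K σ c (toℕ (c x))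
cyclesColoured-≥2 {m} σ c x y inj invariant σx≡x y≢x cy≡cx =
  subst (2 ≤_) (sym (trans (count≡∑ (suc m) Q) (sum-remove {i = x} (ind ∘ Q))))
        (subst (λ b → 2 ≤ ind b + ∑[ z < m ] ind (Q (punchIn x z))) (sym Qx) (s≤s Q-elsewhere))
  where
  Q : Fin (suc m) → Bool
  Q z = isRep (suc m) σ z ∧ (toℕ (c z) ≡ᵇ toℕ (c x))
  n = proj₁ (orbit-has-rep σ y)
  r = iter σ n y
  r≢x : r ≢ x
  r≢x e = y≢x (iter-injective σ inj n (trans e (sym (iter-fixedPoint σ x σx≡x n))))
  Qr : Q r ≡ true
  Qr = ∧-intro (proj₂ (orbit-has-rep σ y)) (≡ᵇ-complete (cong toℕ (trans (iter-invariant σ c invariant n y) cy≡cx)))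
  Qx : Q x ≡ true
  Qx = ∧-intro (isRep-fixedPoint σ x σx≡x) (≡ᵇ-complete (refl {x = toℕ (c x)}))
  Q-elsewhere : 1 ≤ ∑[ z < m ] ind (Q (punchIn x z))
  Q-elsewhere = ∑-ind≥1 m (Q ∘ punchIn x) (punchOut (r≢x ∘ sym))
    (subst (λ w → Q w ≡ true) (sym (Fin.punchIn-punchOut (r≢x ∘ sym))) Qr)

Valid-colourClash : ∀ S m k t (σ : Fin (suc m) → Fin (suc m)) (c : Fin (suc m) → Fin k) x y →
  σ x ≡ x → y ≢ x → c y ≡ c x → (toℕ (c x) ≡ᵇ 0) ≡ false → Valid S (suc m) k t σ c ≡ false
Valid-colourClash S m k t σ c x y σx≡x y≢x cy≡cx cx≢0 with Valid S (suc m) k t σ c in valid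
... | false = refl
... | true  = ⊥-elim (<-irrefl refl (subst (1 <_) (Valid⇒onceColoured S t σ c valid (c x) cx≢0)
    (cyclesColoured-≥2 σ c x y (Valid⇒injective S t σ c valid) (Valid⇒colourInvariant S t σ c valid) σx≡x y≢x cy≡cx)))

without1-cycLen : ∀ S {m} (σ : Fin m → Fin m) z → without1 S (cycLen m σ z) ≡ S (cycLen m σ z) ∧ not (σ z == z)
without1-cycLen S {suc m} σ z with cycLen (suc m) σ z ≡ᵇ 1 | cycLen≡ᵇ1 σ z
... | _ | e with σ z == z
without1-cycLen S {suc m} σ z | .true  | refl | true  = sym (∧-zeroʳ _)
without1-cycLen S {suc m} σ z | .false | refl | false = sym (∧-identityʳ _)

noFixedPoint⇔ : ∀ m {k} (σ : Fin m → Fin m) (c : Fin m → Fin k) →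
  allF m (λ z → not (σ z == z)) ≡ ((specialFixed m σ c ≡ᵇ 0) ∧ (ordinaryFixed m σ c ≡ᵇ 0))
noFixedPoint⇔ m σ c = Bool-ext
  (λ e → ∧-intro (none sp (λ z → notFixed⇒ (allF⁻ {p = λ z → not (σ z == z)} e z) .proj₁))
                 (none op (λ z → notFixed⇒ (allF⁻ {p = λ z → not (σ z == z)} e z) .proj₂)))
  (λ e → allF⁺ {p = λ z → not (σ z == z)} (λ z → ⇒notFixed z
      (∑-ind≡0⁻ m sp (trans (sym (count≡∑ m sp)) (≡ᵇ-sound (∧-conicalˡ _ _ e))) z)
      (∑-ind≡0⁻ m op (trans (sym (count≡∑ m op)) (≡ᵇ-sound (∧-conicalʳ (specialFixed m σ c ≡ᵇ 0) _ e))) z)))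
  where
  sp op : Fin m → Bool
  sp z = (σ z == z) ∧ (toℕ (c z) ≡ᵇ 0)
  op z = (σ z == z) ∧ not (toℕ (c z) ≡ᵇ 0)
  none : ∀ p → (∀ z → p z ≡ false) → (count p (allFin m) ≡ᵇ 0) ≡ true
  none p h = ≡ᵇ-complete (trans (count≡∑ m p) (∑-ind≡0⁺ m p h))
  notFixed⇒ : ∀ {z} → not (σ z == z) ≡ true → sp z ≡ false × op z ≡ false
  notFixed⇒ {z} e with σ z == z
  ... | false = refl , refl
  ⇒notFixed : ∀ z → sp z ≡ false → op z ≡ false → not (σ z == z) ≡ true
  ⇒notFixed z e₁ e₂ with σ z == z | toℕ (c z) ≡ᵇ 0
  ⇒notFixed z () e₂ | true | true
  ⇒notFixed z e₁ () | true | false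
  ... | false | _ = refl

Valid-without1 : ∀ S m k t (σ : Fin m → Fin m) (c : Fin m → Fin k) →
  Valid (without1 S) m k t σ c ≡ Valid S m k t σ c ∧ ((specialFixed m σ c ≡ᵇ 0) ∧ (ordinaryFixed m σ c ≡ᵇ 0))
Valid-without1 S m k t σ c =
  trans (cong (λ b → isPerm m σ ∧ b ∧ Cs ∧ C0 ∧ Js)
              (trans (allF-cong m (without1-cycLen S σ))
              (trans (allF-∧ m (λ z → S (cycLen m σ z)) (λ z → not (σ z == z)))
                     (cong (allF m (λ z → S (cycLen m σ z)) ∧_) (noFixedPoint⇔ m σ c)))))
        (rearrange (isPerm m σ) (allF m (λ z → S (cycLen m σ z))) _ Cs C0 Js)
  where
  Cs = allF m (λ z → toℕ (c (σ z)) ≡ᵇ toℕ (c z))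
  C0 = cyclesColoured m k σ c 0 ≡ᵇ t
  Js = allF k (λ j → (toℕ j ≡ᵇ 0) ∨ (cyclesColoured m k σ c (toℕ j) ≡ᵇ 1))
  rearrange : ∀ a b f c d e → (a ∧ (b ∧ f) ∧ c ∧ d ∧ e) ≡ ((a ∧ b ∧ c ∧ d ∧ e) ∧ f)
  rearrange false b     f     c d e = refl
  rearrange true  false f     c d e = refl
  rearrange true  true  true  c d e = sym (∧-identityʳ _)
  rearrange true  true  false c d e = sym (∧-zeroʳ _)

-- Adjoining a fixed point x to a permutation σ′ of [m]

module AdjoinFixedPoint {m : ℕ} (x : Fin (suc m)) (σ : Fin (suc m) → Fin (suc m)) (σ′ : Fin m → Fin m)
  (σx≡x : σ x ≡ x) (σ-punchIn : ∀ y → σ (punchIn x y) ≡ punchIn x (σ′ y)) where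

  private
    σ-punchIn≢x : ∀ y → σ (punchIn x y) ≢ x
    σ-punchIn≢x y e = Fin.punchInᵢ≢i x (σ′ y) (trans (sym (σ-punchIn y)) e)

    injective⁺ : Injective _≡_ _≡_ σ′ → Injective _≡_ _≡_ σ
    injective⁺ inj {a} {b} e with a Fin.≟ x | b Fin.≟ x
    ... | yes a≡x | yes b≡x = trans a≡x (sym b≡x)
    ... | yes refl | no b≢x = ⊥-elim (σ-punchIn≢x _ (subst (λ w → σ w ≡ x) (sym (Fin.punchIn-punchOut (b≢x ∘ sym))) (trans (sym e) σx≡x)))
    ... | no a≢x | yes refl = ⊥-elim (σ-punchIn≢x _ (subst (λ w → σ w ≡ x) (sym (Fin.punchIn-punchOut (a≢x ∘ sym))) (trans e σx≡x)))
    ... | no a≢x | no b≢x = begin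
      a                                ≡⟨ Fin.punchIn-punchOut (a≢x ∘ sym) ⟨
      punchIn x (punchOut (a≢x ∘ sym)) ≡⟨ cong (punchIn x) (inj (Fin.punchIn-injective x _ _ σ′-eq)) ⟩
      punchIn x (punchOut (b≢x ∘ sym)) ≡⟨ Fin.punchIn-punchOut (b≢x ∘ sym) ⟩
      b                                ∎
      where
      open ≡-Reasoning
      σ′-eq : punchIn x (σ′ (punchOut (a≢x ∘ sym))) ≡ punchIn x (σ′ (punchOut (b≢x ∘ sym)))
      σ′-eq = trans (sym (σ-punchIn _))
              (trans (cong σ (Fin.punchIn-punchOut (a≢x ∘ sym)))
              (trans e (trans (cong σ (sym (Fin.punchIn-punchOut (b≢x ∘ sym)))) (σ-punchIn _))))

    surjective⁻ : Surjective σ → Surjective σ′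
    surjective⁻ surj b with surj (punchIn x b)
    ... | a , e with a Fin.≟ x
    ...   | yes refl = ⊥-elim (Fin.punchInᵢ≢i x b (trans (sym e) σx≡x))
    ...   | no a≢x = punchOut (a≢x ∘ sym) , Fin.punchIn-injective x _ _
              (trans (sym (σ-punchIn _)) (trans (cong σ (Fin.punchIn-punchOut (a≢x ∘ sym))) e))

    surjective⁺ : Surjective σ′ → Surjective σ
    surjective⁺ surj b with b Fin.≟ x
    ... | yes refl = x , σx≡x
    ... | no b≢x = let (a , e) = surj (punchOut (b≢x ∘ sym)) in
      punchIn x a , trans (σ-punchIn a) (trans (cong (punchIn x) e) (Fin.punchIn-punchOut (b≢x ∘ sym)))

    iter-punchIn : ∀ p y → iter σ p (punchIn x y) ≡ punchIn x (iter σ′ p y)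
    iter-punchIn zero    y = refl
    iter-punchIn (suc p) y = trans (cong σ (iter-punchIn p y)) (σ-punchIn _)

    cycLenFrom-punchIn : ∀ y q f → cycLenFrom σ (punchIn x y) q f ≡ cycLenFrom σ′ y q f
    cycLenFrom-punchIn y q zero = refl
    cycLenFrom-punchIn y q (suc f)
      rewrite iter-punchIn q y | ==-punchIn x (iter σ′ q y) y | cycLenFrom-punchIn y (suc q) f = refl

  injective-restrict : Injective _≡_ _≡_ σ → Injective _≡_ _≡_ σ′
  injective-restrict inj {a} {b} e =
    Fin.punchIn-injective x a b (inj (trans (σ-punchIn a) (trans (cong (punchIn x) e) (sym (σ-punchIn b)))))

  isPerm-adjoin : isPerm (suc m) σ ≡ isPerm m σ′
  isPerm-adjoin = Bool-ext
    (λ e → isPerm-intro (injective-restrict (isPerm⇒injective e)) (surjective⁻ (isPerm⇒surjective e)))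
    (λ e → isPerm-intro (injective⁺ (isPerm⇒injective e)) (surjective⁺ (isPerm⇒surjective e)))

  cycLen-x : cycLen (suc m) σ x ≡ 1
  cycLen-x rewrite σx≡x | ==-complete (refl {x = x}) = refl

  cycLen-punchIn : Injective _≡_ _≡_ σ′ → ∀ y → cycLen (suc m) σ (punchIn x y) ≡ cycLen m σ′ y
  cycLen-punchIn inj y with period σ′ inj y
  ... | L , 1≤L , L≤m , σ′ᴸy≡y =
    trans (cycLenFrom-punchIn y 1 (suc m))
    (trans (cong (cycLenFrom σ′ y 1) (+-comm 1 m))
           (cycLenFrom-fuel σ′ y m 1 1 L 1≤L (s≤s L≤m) σ′ᴸy≡y))

  -- The orbit of y under σ′ is already exhausted by the first m iterates, as its period is at most m.
  isRep-punchIn : Injective _≡_ _≡_ σ′ → ∀ y → isRep (suc m) σ (punchIn x y) ≡ isRep m σ′ y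
  isRep-punchIn inj y with period σ′ inj y
  ... | suc L , _ , L≤m , σ′ᴸy≡y =
    trans (allBelow-cong (suc m) (λ q → trans (cong (λ w → toℕ (punchIn x y) ≤ᵇ toℕ w) (iter-punchIn q y))
                                              (≤ᵇ-punchIn y (iter σ′ q y))))
          (Bool-ext (λ e → allBelow⁺ {m} {P} (λ q q<m → allBelow⁻ {suc m} {P} e q (m≤n⇒m≤1+n q<m)))
                    (λ e → allBelow⁺ {suc m} {P} (below-suc e)))
    where
    P : ℕ → Bool
    P q = toℕ y ≤ᵇ toℕ (iter σ′ q y)
    ≤ᵇ-punchIn : ∀ a b → (toℕ (punchIn x a) ≤ᵇ toℕ (punchIn x b)) ≡ (toℕ a ≤ᵇ toℕ b)
    ≤ᵇ-punchIn a b = Bool-ext (≤ᵇ-complete ∘ Fin.punchIn-cancel-≤ x a b ∘ ≤ᵇ-sound)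
                              (≤ᵇ-complete ∘ Fin.punchIn-mono-≤ x a b ∘ ≤ᵇ-sound)
    below-suc : allBelow m P ≡ true → ∀ q → q < suc m → P q ≡ true
    below-suc e q q<1+m with m≤n⇒m<n∨m≡n (≤-pred q<1+m)
    ... | inj₁ q<m = allBelow⁻ e q q<m
    ... | inj₂ refl = subst (λ w → (toℕ y ≤ᵇ toℕ w) ≡ true) (sym (iter-period-% σ′ (suc L) y σ′ᴸy≡y q))
                        (allBelow⁻ e (q % suc L) (<-≤-trans (m%n<n q (suc L)) L≤m))

  cyclesColoured-adjoin : Injective _≡_ _≡_ σ′ → ∀ {K} (c : Fin (suc m) → Fin K) j →
    cyclesColoured (suc m) K σ c j
      ≡ ind (toℕ (c x) ≡ᵇ j) + ∑[ y < m ] ind (isRep m σ′ y ∧ (toℕ (c (punchIn x y)) ≡ᵇ j))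
  cyclesColoured-adjoin inj c j = begin
    cyclesColoured (suc m) _ σ c j                                 ≡⟨ count≡∑ (suc m) _ ⟩
    ∑[ z < suc m ] ind (isRep (suc m) σ z ∧ (toℕ (c z) ≡ᵇ j))      ≡⟨ sum-remove {i = x} (λ z → ind (isRep (suc m) σ z ∧ (toℕ (c z) ≡ᵇ j))) ⟩
    ind (isRep (suc m) σ x ∧ (toℕ (c x) ≡ᵇ j)) + _                 ≡⟨ cong₂ _+_
      (cong (λ b → ind (b ∧ (toℕ (c x) ≡ᵇ j))) (isRep-fixedPoint σ x σx≡x))
      (sum-cong-≗ (λ y → cong (λ b → ind (b ∧ (toℕ (c (punchIn x y)) ≡ᵇ j))) (isRep-punchIn inj y))) ⟩
    _                                                              ∎
    where open ≡-Reasoning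

  allCycLen-adjoin : (S : ℕ → Bool) → S 1 ≡ true → Injective _≡_ _≡_ σ′ →
    allF (suc m) (λ z → S (cycLen (suc m) σ z)) ≡ allF m (λ y → S (cycLen m σ′ y))
  allCycLen-adjoin S S1 inj = trans (allF-punchIn x (λ z → S (cycLen (suc m) σ z)))
    (cong₂ _∧_ (trans (cong S cycLen-x) S1) (allF-cong m (λ y → cong S (cycLen-punchIn inj y))))

  isFixed-x : (σ x == x) ≡ true
  isFixed-x = ==-complete σx≡x

  isFixed-punchIn : ∀ y → (σ (punchIn x y) == punchIn x y) ≡ (σ′ y == y)
  isFixed-punchIn y = trans (cong (_== punchIn x y) (σ-punchIn y)) (==-punchIn x (σ′ y) y)

  colourInvariant-adjoin : ∀ {K K′} (c : Fin (suc m) → Fin K) (c′ : Fin m → Fin K′) (f : Fin K′ → Fin K) →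
    (∀ a b → (f a == f b) ≡ (a == b)) → (∀ y → c (punchIn x y) ≡ f (c′ y)) →
    allF (suc m) (λ z → c (σ z) == c z) ≡ allF m (λ y → c′ (σ′ y) == c′ y)
  colourInvariant-adjoin c c′ f f-== c-punchIn = trans (allF-punchIn x (λ z → c (σ z) == c z))
    (cong₂ _∧_ (==-complete (cong c σx≡x))
               (allF-cong m (λ y → trans (cong₂ _==_ (trans (cong c (σ-punchIn y)) (c-punchIn (σ′ y))) (c-punchIn y))
                                          (f-== (c′ (σ′ y)) (c′ y)))))

  fixedCount-adjoin : ∀ {K} (c : Fin (suc m) → Fin K) (P : Fin K → Bool) →
    count (λ z → (σ z == z) ∧ P (c z)) (allFin (suc m))
      ≡ ind (P (c x)) + count (λ y → (σ′ y == y) ∧ P (c (punchIn x y))) (allFin m)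
  fixedCount-adjoin c P = begin
    count (λ z → (σ z == z) ∧ P (c z)) (allFin (suc m))           ≡⟨ count≡∑ (suc m) _ ⟩
    ∑[ z < suc m ] ind ((σ z == z) ∧ P (c z))                      ≡⟨ sum-remove {i = x} (λ z → ind ((σ z == z) ∧ P (c z))) ⟩
    ind ((σ x == x) ∧ P (c x)) + ∑[ y < m ] ind ((σ (punchIn x y) == punchIn x y) ∧ P (c (punchIn x y)))
      ≡⟨ cong₂ _+_ (cong (λ b → ind (b ∧ P (c x))) isFixed-x)
                   (sum-cong-≗ (λ y → cong (λ b → ind (b ∧ P (c (punchIn x y)))) (isFixed-punchIn y))) ⟩
    ind (P (c x)) + ∑[ y < m ] ind ((σ′ y == y) ∧ P (c (punchIn x y))) ≡⟨ cong (ind (P (c x)) +_) (count≡∑ m _) ⟨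
    ind (P (c x)) + count (λ y → (σ′ y == y) ∧ P (c (punchIn x y))) (allFin m) ∎
    where open ≡-Reasoning

  module RemoveSpecial {k} (c : Fin (suc m) → Fin (suc k)) (c′ : Fin m → Fin (suc k))
    (cx≡0 : c x ≡ fz) (c-punchIn : ∀ y → c (punchIn x y) ≡ c′ y) where

    cyclesColoured-removeSpecial : Injective _≡_ _≡_ σ′ → ∀ j →
      cyclesColoured (suc m) (suc k) σ c j ≡ ind (0 ≡ᵇ j) + cyclesColoured m (suc k) σ′ c′ j
    cyclesColoured-removeSpecial inj j = trans (cyclesColoured-adjoin inj c j)
      (cong₂ _+_ (cong (λ w → ind (toℕ w ≡ᵇ j)) cx≡0)
                 (trans (sum-cong-≗ (λ y → cong (λ w → ind (isRep m σ′ y ∧ (toℕ w ≡ᵇ j))) (c-punchIn y)))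
                        (sym (count≡∑ m _))))

    Valid-removeSpecial : ∀ S → S 1 ≡ true → ∀ t → Valid S (suc m) (suc k) (suc t) σ c ≡ Valid S m (suc k) t σ′ c′
    Valid-removeSpecial S S1 t rewrite isPerm-adjoin with isPerm m σ′ in perm
    ... | false = refl
    ... | true  = cong₂ _∧_ (allCycLen-adjoin S S1 inj)
                 (cong₂ _∧_ (colourInvariant-adjoin c c′ id (λ _ _ → refl) c-punchIn)
                 (cong₂ _∧_ (cong (_≡ᵇ suc t) (cyclesColoured-removeSpecial inj 0))
                            (allF-cong (suc k) onceColoured)))
      where
      inj = isPerm⇒injective perm
      onceColoured : ∀ j → ((toℕ j ≡ᵇ 0) ∨ (cyclesColoured (suc m) (suc k) σ c (toℕ j) ≡ᵇ 1))
                         ≡ ((toℕ j ≡ᵇ 0) ∨ (cyclesColoured m (suc k) σ′ c′ (toℕ j) ≡ᵇ 1))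
      onceColoured fz     = refl
      onceColoured (fs j) = cong (_≡ᵇ 1) (cyclesColoured-removeSpecial inj (suc (toℕ j)))

    Valid-noSpecialCycle : ∀ S → Valid S (suc m) (suc k) 0 σ c ≡ false
    Valid-noSpecialCycle S with Valid S (suc m) (suc k) 0 σ c in valid
    ... | false = refl
    ... | true  = contradiction (trans (sym (cyclesColoured-removeSpecial inj 0)) (Valid⇒specialCycles S 0 σ c valid)) λ ()
      where
      inj = injective-restrict (Valid⇒injective S 0 σ c valid)

    specialFixed-removeSpecial : specialFixed (suc m) σ c ≡ suc (specialFixed m σ′ c′)
    specialFixed-removeSpecial = trans (fixedCount-adjoin c (λ w → toℕ w ≡ᵇ 0))
      (cong₂ _+_ (cong (λ w → ind (toℕ w ≡ᵇ 0)) cx≡0)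
                 (count-cong (allFin m) (λ y → cong (λ w → (σ′ y == y) ∧ (toℕ w ≡ᵇ 0)) (c-punchIn y))))

    ordinaryFixed-removeSpecial : ordinaryFixed (suc m) σ c ≡ ordinaryFixed m σ′ c′
    ordinaryFixed-removeSpecial = trans (fixedCount-adjoin c (λ w → not (toℕ w ≡ᵇ 0)))
      (cong₂ _+_ (cong (λ w → ind (not (toℕ w ≡ᵇ 0))) cx≡0)
                 (count-cong (allFin m) (λ y → cong (λ w → (σ′ y == y) ∧ not (toℕ w ≡ᵇ 0)) (c-punchIn y))))

  module RemoveOrdinary {k} (d : Fin k) (c : Fin (suc m) → Fin (suc k)) (c′ : Fin m → Fin k)
    (cx≡d : c x ≡ fs d) (c-punchIn : ∀ y → c (punchIn x y) ≡ punchIn (fs d) (c′ y)) where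

    private
      isSpecial-punchIn : ∀ a → (toℕ (punchIn (fs d) a) ≡ᵇ 0) ≡ (toℕ a ≡ᵇ 0)
      isSpecial-punchIn fz     = refl
      isSpecial-punchIn (fs a) = refl

    cyclesColoured-removed : Injective _≡_ _≡_ σ′ → cyclesColoured (suc m) (suc k) σ c (toℕ (fs d)) ≡ 1
    cyclesColoured-removed inj = trans (cyclesColoured-adjoin inj c (toℕ (fs d)))
      (cong₂ _+_ (trans (cong (λ w → ind (toℕ w ≡ᵇ toℕ (fs d))) cx≡d) (cong ind (≡ᵇ-complete (refl {x = toℕ (fs d)}))))
                 (∑-zero m _ λ y → trans (cong (λ w → ind (isRep m σ′ y ∧ (w == fs d))) (c-punchIn y))
                                         (cong (λ b → ind (isRep m σ′ y ∧ b)) (==-false (Fin.punchInᵢ≢i (fs d) (c′ y))))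
                                   ∙ cong ind (∧-zeroʳ _)))
      where _∙_ = trans

    cyclesColoured-relabel : Injective _≡_ _≡_ σ′ → ∀ J j → (toℕ (fs d) ≡ᵇ J) ≡ false →
      (∀ a → (toℕ (punchIn (fs d) a) ≡ᵇ J) ≡ (toℕ a ≡ᵇ j)) →
      cyclesColoured (suc m) (suc k) σ c J ≡ cyclesColoured m k σ′ c′ j
    cyclesColoured-relabel inj J j d≢J relabel = trans (cyclesColoured-adjoin inj c J)
      (cong₂ _+_ (trans (cong (λ w → ind (toℕ w ≡ᵇ J)) cx≡d) (cong ind d≢J))
                 (trans (sum-cong-≗ (λ y → trans (cong (λ w → ind (isRep m σ′ y ∧ (toℕ w ≡ᵇ J))) (c-punchIn y))
                                                 (cong (λ b → ind (isRep m σ′ y ∧ b)) (relabel (c′ y)))))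
                        (sym (count≡∑ m _))))

    cyclesColoured-punchIn : Injective _≡_ _≡_ σ′ → ∀ j →
      cyclesColoured (suc m) (suc k) σ c (toℕ (punchIn (fs d) j)) ≡ cyclesColoured m k σ′ c′ (toℕ j)
    cyclesColoured-punchIn inj j = cyclesColoured-relabel inj _ _
      (==-false (Fin.punchInᵢ≢i (fs d) j ∘ sym)) (λ a → ==-punchIn (fs d) a j)

    cyclesColoured-special : Injective _≡_ _≡_ σ′ →
      cyclesColoured (suc m) (suc k) σ c 0 ≡ cyclesColoured m k σ′ c′ 0
    cyclesColoured-special inj = cyclesColoured-relabel inj 0 0 refl isSpecial-punchIn

    Valid-removeOrdinary : ∀ S → S 1 ≡ true → ∀ t → Valid S (suc m) (suc k) t σ c ≡ Valid S m k t σ′ c′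
    Valid-removeOrdinary S S1 t rewrite isPerm-adjoin with isPerm m σ′ in perm
    ... | false = refl
    ... | true  = cong₂ _∧_ (allCycLen-adjoin S S1 inj)
                 (cong₂ _∧_ (colourInvariant-adjoin c c′ (punchIn (fs d)) (==-punchIn (fs d)) c-punchIn)
                 (cong₂ _∧_ (cong (_≡ᵇ t) (cyclesColoured-special inj))
                            onceColoured))
      where
      inj = isPerm⇒injective perm
      onceColoured : allF (suc k) (λ j → (toℕ j ≡ᵇ 0) ∨ (cyclesColoured (suc m) (suc k) σ c (toℕ j) ≡ᵇ 1))
                   ≡ allF k (λ j → (toℕ j ≡ᵇ 0) ∨ (cyclesColoured m k σ′ c′ (toℕ j) ≡ᵇ 1))
      onceColoured = trans (allF-punchIn (fs d) (λ j → (toℕ j ≡ᵇ 0) ∨ (cyclesColoured (suc m) (suc k) σ c (toℕ j) ≡ᵇ 1)))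
        (cong₂ _∧_ (cong (_≡ᵇ 1) (cyclesColoured-removed inj))
                   (allF-cong k (λ j → cong₂ _∨_ (isSpecial-punchIn j) (cong (_≡ᵇ 1) (cyclesColoured-punchIn inj j)))))

    specialFixed-removeOrdinary : specialFixed (suc m) σ c ≡ specialFixed m σ′ c′
    specialFixed-removeOrdinary = trans (fixedCount-adjoin c (λ w → toℕ w ≡ᵇ 0))
      (cong₂ _+_ (cong (λ w → ind (toℕ w ≡ᵇ 0)) cx≡d)
                 (count-cong (allFin m) (λ y → cong (λ w → (σ′ y == y) ∧ (toℕ w ≡ᵇ 0)) (c-punchIn y)
                                               ∙ cong ((σ′ y == y) ∧_) (isSpecial-punchIn (c′ y)))))
      where _∙_ = trans

    ordinaryFixed-removeOrdinary : ordinaryFixed (suc m) σ c ≡ suc (ordinaryFixed m σ′ c′)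
    ordinaryFixed-removeOrdinary = trans (fixedCount-adjoin c (λ w → not (toℕ w ≡ᵇ 0)))
      (cong₂ _+_ (cong (λ w → ind (not (toℕ w ≡ᵇ 0))) cx≡d)
                 (count-cong (allFin m) (λ y → cong (λ w → (σ′ y == y) ∧ not (toℕ w ≡ᵇ 0)) (c-punchIn y)
                                               ∙ cong (λ b → (σ′ y == y) ∧ not b) (isSpecial-punchIn (c′ y)))))
      where _∙_ = trans

-- Counting coloured permutations by their fixed points

adjoinFixed : ∀ {m} → Fin (suc m) → Vec (Fin m) m → Vec (Fin (suc m)) (suc m)
adjoinFixed x v = insertAt (Vec.map (punchIn x) v) x x

lookup-adjoinFixed-x : ∀ {m} (x : Fin (suc m)) (v : Vec (Fin m) m) → lookup (adjoinFixed x v) x ≡ x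
lookup-adjoinFixed-x x v = Vec.insertAt-lookup (Vec.map (punchIn x) v) x x

lookup-adjoinFixed-punchIn : ∀ {m} (x : Fin (suc m)) (v : Vec (Fin m) m) y →
  lookup (adjoinFixed x v) (punchIn x y) ≡ punchIn x (lookup v y)
lookup-adjoinFixed-punchIn x v y =
  trans (Vec.insertAt-punchIn (Vec.map (punchIn x) v) x x y) (Vec.lookup-map y (punchIn x) v)

double-count : ∀ n m K M a (W : Vec (Fin n) m → Vec (Fin K) m → Bool) (F : Vec (Fin n) m → Vec (Fin K) m → Fin M → Bool) →
  (∀ vσ vc → W vσ vc ≡ true → ∑[ x < M ] ind (F vσ vc x) ≡ a) →
  a * ∑ᵥ n m (λ vσ → ∑ᵥ K m (λ vc → ind (W vσ vc)))
    ≡ ∑[ x < M ] ∑ᵥ n m (λ vσ → ∑ᵥ K m (λ vc → ind (W vσ vc) * ind (F vσ vc x)))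
double-count n m K M a W F marks = begin
  a * ∑ᵥ n m (λ vσ → ∑ᵥ K m (λ vc → ind (W vσ vc)))                    ≡⟨ *-distribˡ-∑ᵥ n m a _ ⟩
  ∑ᵥ n m (λ vσ → a * ∑ᵥ K m (λ vc → ind (W vσ vc)))                    ≡⟨ ∑ᵥ-cong n m (λ vσ → *-distribˡ-∑ᵥ K m a _) ⟩
  ∑ᵥ n m (λ vσ → ∑ᵥ K m (λ vc → a * ind (W vσ vc)))                    ≡⟨ ∑ᵥ-cong n m (λ vσ → ∑ᵥ-cong K m (λ vc → pointwise vσ vc (W vσ vc) refl)) ⟩
  ∑ᵥ n m (λ vσ → ∑ᵥ K m (λ vc → ∑[ x < M ] (ind (W vσ vc) * ind (F vσ vc x))))
    ≡⟨ ∑ᵥ-cong n m (λ vσ → ∑ᵥ-comm-∑ K m M (λ vc x → ind (W vσ vc) * ind (F vσ vc x))) ⟩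
  ∑ᵥ n m (λ vσ → ∑[ x < M ] ∑ᵥ K m (λ vc → ind (W vσ vc) * ind (F vσ vc x)))
    ≡⟨ ∑ᵥ-comm-∑ n m M (λ vσ x → ∑ᵥ K m (λ vc → ind (W vσ vc) * ind (F vσ vc x))) ⟩
  ∑[ x < M ] ∑ᵥ n m (λ vσ → ∑ᵥ K m (λ vc → ind (W vσ vc) * ind (F vσ vc x))) ∎
  where
  open ≡-Reasoning
  pointwise : ∀ vσ vc b → W vσ vc ≡ b → a * ind b ≡ ∑[ x < M ] (ind b * ind (F vσ vc x))
  pointwise vσ vc true  e = trans (*-identityʳ a) (trans (sym (marks vσ vc e)) (sum-cong-≗ {M} (λ x → sym (+-identityʳ _))))
  pointwise vσ vc false e = trans (*-zeroʳ a) (sym (∑-zero M _ (λ _ → refl)))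

-- Only σ x = x survives, and then injectivity keeps the other values of σ away from x.
∑ᵥ-fixedAt : ∀ m K (x : Fin (suc m)) (W : Vec (Fin (suc m)) (suc m) → Vec (Fin K) (suc m) → Bool)
  (E : Vec (Fin K) (suc m) → Bool) →
  (∀ vσ vc a b → lookup vσ a ≡ lookup vσ b → a ≢ b → W vσ vc ≡ false) →
  ∑ᵥ (suc m) (suc m) (λ vσ → ∑ᵥ K (suc m) (λ vc → ind (W vσ vc) * ind ((lookup vσ x == x) ∧ E vc)))
    ≡ ∑ᵥ m m (λ v → ∑ᵥ K (suc m) (λ vc → ind (W (adjoinFixed x v) vc) * ind (E vc)))
∑ᵥ-fixedAt m K x W E nonInjective = begin
  ∑ᵥ (suc m) (suc m) Φ                                        ≡⟨ ∑ᵥ-insertAt (suc m) m x Φ ⟩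
  ∑[ a < suc m ] ∑ᵥ (suc m) m (λ v → Φ (insertAt v x a))      ≡⟨ sum-remove {i = x} (λ a → ∑ᵥ (suc m) m (λ v → Φ (insertAt v x a))) ⟩
  ∑ᵥ (suc m) m (λ v → Φ (insertAt v x x)) + ∑[ b < m ] ∑ᵥ (suc m) m (λ v → Φ (insertAt v x (punchIn x b)))
    ≡⟨ cong₂ _+_ (∑ᵥ-cong (suc m) m (λ v → ∑ᵥ-cong K (suc m) (λ vc →
                    cong (λ w → ind (W (insertAt v x x) vc) * ind (w ∧ E vc)) (==-complete (Vec.insertAt-lookup v x x)))))
                 (∑-zero m _ (λ b → ∑ᵥ-zero (suc m) m _ (λ v → ∑ᵥ-zero K (suc m) _ (λ vc → notFixed b v vc)))) ⟩
  ∑ᵥ (suc m) m (λ v → Ψ (insertAt v x x)) + 0                 ≡⟨ +-identityʳ _ ⟩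
  ∑ᵥ (suc m) m (λ v → Ψ (insertAt v x x))                     ≡⟨ ∑ᵥ-avoid m m x (λ v → Ψ (insertAt v x x)) avoids ⟩
  ∑ᵥ m m (λ v → Ψ (adjoinFixed x v))                          ∎
  where
  open ≡-Reasoning
  Φ Ψ : Vec (Fin (suc m)) (suc m) → ℕ
  Φ vσ = ∑ᵥ K (suc m) (λ vc → ind (W vσ vc) * ind ((lookup vσ x == x) ∧ E vc))
  Ψ vσ = ∑ᵥ K (suc m) (λ vc → ind (W vσ vc) * ind (E vc))
  notFixed : ∀ b v vc → ind (W (insertAt v x (punchIn x b)) vc) * ind ((lookup (insertAt v x (punchIn x b)) x == x) ∧ E vc) ≡ 0
  notFixed b v vc = trans (cong (λ w → ind (W (insertAt v x (punchIn x b)) vc) * ind ((w == x) ∧ E vc)) (Vec.insertAt-lookup v x (punchIn x b)))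
                          (trans (cong (λ w → ind (W (insertAt v x (punchIn x b)) vc) * ind (w ∧ E vc)) (==-false (Fin.punchInᵢ≢i x b)))
                                 (*-zeroʳ (ind (W (insertAt v x (punchIn x b)) vc))))
  avoids : ∀ v i → lookup v i ≡ x → Ψ (insertAt v x x) ≡ 0
  avoids v i e = ∑ᵥ-zero K (suc m) _ (λ vc → cong (_* ind (E vc)) (ind-false
    (nonInjective (insertAt v x x) vc x (punchIn x i)
      (trans (Vec.insertAt-lookup v x x) (sym (trans (Vec.insertAt-punchIn v x x i) e)))
      (Fin.punchInᵢ≢i x i ∘ sym))))

∑ᵥ-specialAt : ∀ m k (x : Fin (suc m)) (W : Vec (Fin (suc k)) (suc m) → Bool) →
  ∑ᵥ (suc k) (suc m) (λ vc → ind (W vc) * ind (toℕ (lookup vc x) ≡ᵇ 0))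
    ≡ ∑ᵥ (suc k) m (λ w → ind (W (insertAt w x fz)))
∑ᵥ-specialAt m k x W =
  trans (∑ᵥ-insertAt (suc k) m x (λ vc → ind (W vc) * ind (toℕ (lookup vc x) ≡ᵇ 0)))
  (trans (cong₂ _+_ (∑ᵥ-cong (suc k) m (λ w → trans (cong (λ u → ind (W (insertAt w x fz)) * ind (toℕ u ≡ᵇ 0)) (Vec.insertAt-lookup w x fz))
                                                  (*-identityʳ (ind (W (insertAt w x fz))))))
                    (∑-zero k _ (λ d → ∑ᵥ-zero (suc k) m _ (λ w →
                      trans (cong (λ u → ind (W (insertAt w x (fs d))) * ind (toℕ u ≡ᵇ 0)) (Vec.insertAt-lookup w x (fs d)))
                            (*-zeroʳ (ind (W (insertAt w x (fs d)))))))))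
         (+-identityʳ _))

-- A non-special colour d at x can occur nowhere else, so the other colours avoid d.
∑ᵥ-ordinaryAt : ∀ m k (x : Fin (suc m)) (W : Vec (Fin (suc k)) (suc m) → Bool) →
  (∀ d w i → lookup w i ≡ fs d → W (insertAt w x (fs d)) ≡ false) →
  ∑ᵥ (suc k) (suc m) (λ vc → ind (W vc) * ind (not (toℕ (lookup vc x) ≡ᵇ 0)))
    ≡ ∑[ d < k ] ∑ᵥ k m (λ w → ind (W (insertAt (Vec.map (punchIn (fs d)) w) x (fs d))))
∑ᵥ-ordinaryAt m k x W clash =
  trans (∑ᵥ-insertAt (suc k) m x (λ vc → ind (W vc) * ind (not (toℕ (lookup vc x) ≡ᵇ 0))))
  (cong₂ _+_ (∑ᵥ-zero (suc k) m _ (λ w → trans (cong (λ u → ind (W (insertAt w x fz)) * ind (not (toℕ u ≡ᵇ 0))) (Vec.insertAt-lookup w x fz))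
                                               (*-zeroʳ (ind (W (insertAt w x fz))))))
             (sum-cong-≗ (λ d →
               trans (∑ᵥ-cong (suc k) m (λ w → trans (cong (λ u → ind (W (insertAt w x (fs d))) * ind (not (toℕ u ≡ᵇ 0)))
                                                           (Vec.insertAt-lookup w x (fs d)))
                                                     (*-identityʳ (ind (W (insertAt w x (fs d)))))))
                     (∑ᵥ-avoid k m (fs d) (λ w → ind (W (insertAt w x (fs d)))) (λ w i e → ind-false (clash d w i e))))))

ValidFixed : (S : ℕ → Bool) (m K t i j : ℕ) → Vec (Fin m) m → Vec (Fin K) m → Bool
ValidFixed S m K t i j vσ vc =
  validPair S m K t vσ vc ∧ ((specialFixed m (lookup vσ) (lookup vc) ≡ᵇ i) ∧ (ordinaryFixed m (lookup vσ) (lookup vc) ≡ᵇ j))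

cycNumFixed : (S : ℕ → Bool) (m K t i j : ℕ) → ℕ
cycNumFixed S m K t i j = ∑ᵥ m m (λ vσ → ∑ᵥ K m (λ vc → ind (ValidFixed S m K t i j vσ vc)))

ValidFixed-nonInjective : ∀ S m K t i j (vσ : Vec (Fin m) m) (vc : Vec (Fin K) m) a b →
  lookup vσ a ≡ lookup vσ b → a ≢ b → ValidFixed S m K t i j vσ vc ≡ false
ValidFixed-nonInjective S m K t i j vσ vc a b σa≡σb a≢b =
  cong (_∧ _) (Valid-nonInjective S m K t (lookup vσ) (lookup vc) a b σa≡σb a≢b)

module _ {m : ℕ} (S : ℕ → Bool) (x : Fin (suc m)) (v : Vec (Fin m) m) where

  open AdjoinFixedPoint x (lookup (adjoinFixed x v)) (lookup v) (lookup-adjoinFixed-x x v) (lookup-adjoinFixed-punchIn x v)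

  module _ {k} (w : Vec (Fin (suc k)) m) where
    open RemoveSpecial (lookup (insertAt w x fz)) (lookup w) (Vec.insertAt-lookup w x fz) (Vec.insertAt-punchIn w x fz)

    ValidFixed-removeSpecial : S 1 ≡ true → ∀ t i j →
      ValidFixed S (suc m) (suc k) (suc t) (suc i) j (adjoinFixed x v) (insertAt w x fz) ≡ ValidFixed S m (suc k) t i j v w
    ValidFixed-removeSpecial S1 t i j = cong₂ _∧_ (Valid-removeSpecial S S1 t)
      (cong₂ _∧_ (cong (_≡ᵇ suc i) specialFixed-removeSpecial) (cong (_≡ᵇ j) ordinaryFixed-removeSpecial))

    ValidFixed-noSpecialCycle : ∀ i j → ValidFixed S (suc m) (suc k) 0 i j (adjoinFixed x v) (insertAt w x fz) ≡ false
    ValidFixed-noSpecialCycle i j = cong (_∧ _) (Valid-noSpecialCycle S)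

  module _ {k} (d : Fin k) (w : Vec (Fin k) m) where
    open RemoveOrdinary d (lookup (insertAt (Vec.map (punchIn (fs d)) w) x (fs d))) (lookup w)
      (Vec.insertAt-lookup _ x (fs d))
      (λ y → trans (Vec.insertAt-punchIn (Vec.map (punchIn (fs d)) w) x (fs d) y) (Vec.lookup-map y (punchIn (fs d)) w))

    ValidFixed-removeOrdinary : S 1 ≡ true → ∀ t i j →
      ValidFixed S (suc m) (suc k) t i (suc j) (adjoinFixed x v) (insertAt (Vec.map (punchIn (fs d)) w) x (fs d))
        ≡ ValidFixed S m k t i j v w
    ValidFixed-removeOrdinary S1 t i j = cong₂ _∧_ (Valid-removeOrdinary S S1 t)
      (cong₂ _∧_ (cong (_≡ᵇ i) specialFixed-removeOrdinary) (cong (_≡ᵇ suc j) ordinaryFixed-removeOrdinary))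

  ValidFixed-colourClash : ∀ {k} t i j (d : Fin k) (w : Vec (Fin (suc k)) m) y → lookup w y ≡ fs d →
    ValidFixed S (suc m) (suc k) t i j (adjoinFixed x v) (insertAt w x (fs d)) ≡ false
  ValidFixed-colourClash {k} t i j d w y wy≡d = cong (_∧ _)
    (Valid-colourClash S m (suc k) t (lookup (adjoinFixed x v)) (lookup (insertAt w x (fs d))) x (punchIn x y)
      (lookup-adjoinFixed-x x v) (Fin.punchInᵢ≢i x y)
      (trans (Vec.insertAt-punchIn w x (fs d) y) (trans wy≡d (sym (Vec.insertAt-lookup w x (fs d)))))
      (cong (λ u → toℕ u ≡ᵇ 0) (Vec.insertAt-lookup w x (fs d))))

module _ (S : ℕ → Bool) where

  private
    fixedAt : ∀ {m K} (P : Fin K → Bool) → Vec (Fin m) m → Vec (Fin K) m → Fin m → Bool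
    fixedAt P vσ vc x = (lookup vσ x == x) ∧ P (lookup vc x)

    isSpecial isOrdinary : ∀ {K} → Fin K → Bool
    isSpecial a  = toℕ a ≡ᵇ 0
    isOrdinary a = not (toℕ a ≡ᵇ 0)

  cycNumFixed-markSpecial : ∀ m k t i j →
    suc i * cycNumFixed S (suc m) (suc k) t (suc i) j
      ≡ ∑[ x < suc m ] ∑ᵥ m m (λ v → ∑ᵥ (suc k) m (λ w →
          ind (ValidFixed S (suc m) (suc k) t (suc i) j (adjoinFixed x v) (insertAt w x fz))))
  cycNumFixed-markSpecial m k t i j =
    trans (double-count (suc m) (suc m) (suc k) (suc m) (suc i) W (fixedAt isSpecial) marks)
          (sum-cong-≗ λ x → trans (∑ᵥ-fixedAt m (suc k) x W (λ vc → isSpecial (lookup vc x))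
                                                (ValidFixed-nonInjective S (suc m) (suc k) t (suc i) j))
                                  (∑ᵥ-cong m m (λ v → ∑ᵥ-specialAt m k x (W (adjoinFixed x v)))))
    where
    W = ValidFixed S (suc m) (suc k) t (suc i) j
    marks : ∀ vσ vc → W vσ vc ≡ true → ∑[ x < suc m ] ind (fixedAt isSpecial vσ vc x) ≡ suc i
    marks vσ vc e = trans (sym (count≡∑ (suc m) (fixedAt isSpecial vσ vc)))
                          (≡ᵇ-sound (∧-conicalˡ _ _ (∧-conicalʳ (validPair S (suc m) (suc k) t vσ vc) _ e)))

  cycNumFixed-markOrdinary : ∀ m k t i j →
    suc j * cycNumFixed S (suc m) (suc k) t i (suc j)
      ≡ ∑[ x < suc m ] ∑ᵥ m m (λ v → ∑[ d < k ] ∑ᵥ k m (λ w →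
          ind (ValidFixed S (suc m) (suc k) t i (suc j) (adjoinFixed x v) (insertAt (Vec.map (punchIn (fs d)) w) x (fs d)))))
  cycNumFixed-markOrdinary m k t i j =
    trans (double-count (suc m) (suc m) (suc k) (suc m) (suc j) W (fixedAt isOrdinary) marks)
          (sum-cong-≗ λ x → trans (∑ᵥ-fixedAt m (suc k) x W (λ vc → isOrdinary (lookup vc x))
                                                (ValidFixed-nonInjective S (suc m) (suc k) t i (suc j)))
                                  (∑ᵥ-cong m m (λ v → ∑ᵥ-ordinaryAt m k x (W (adjoinFixed x v))
                                                        (λ d w y → ValidFixed-colourClash S x v t i (suc j) d w y))))
    where
    W = ValidFixed S (suc m) (suc k) t i (suc j)
    marks : ∀ vσ vc → W vσ vc ≡ true → ∑[ x < suc m ] ind (fixedAt isOrdinary vσ vc x) ≡ suc j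
    marks vσ vc e = trans (sym (count≡∑ (suc m) (fixedAt isOrdinary vσ vc)))
      (≡ᵇ-sound (∧-conicalʳ (specialFixed (suc m) (lookup vσ) (lookup vc) ≡ᵇ i) _
                  (∧-conicalʳ (validPair S (suc m) (suc k) t vσ vc) _ e)))

  cycNumFixed-special : S 1 ≡ true → ∀ m k t i j →
    suc i * cycNumFixed S (suc m) (suc k) (suc t) (suc i) j ≡ suc m * cycNumFixed S m (suc k) t i j
  cycNumFixed-special S1 m k t i j =
    trans (cycNumFixed-markSpecial m k (suc t) i j)
          (trans (sum-cong-≗ (λ x → ∑ᵥ-cong m m (λ v → ∑ᵥ-cong (suc k) m (λ w →
                   cong ind (ValidFixed-removeSpecial S x v w S1 t i j)))))
                 (∑-const (suc m) _))

  cycNumFixed-noSpecialCycle : ∀ m k i j → cycNumFixed S (suc m) (suc k) 0 (suc i) j ≡ 0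
  cycNumFixed-noSpecialCycle m k i j = *-cancelˡ-≡ _ 0 (suc i) (begin
    suc i * cycNumFixed S (suc m) (suc k) 0 (suc i) j ≡⟨ cycNumFixed-markSpecial m k 0 i j ⟩
    _                                                  ≡⟨ ∑-zero (suc m) _ (λ x → ∑ᵥ-zero m m _ (λ v → ∑ᵥ-zero (suc k) m _ (λ w →
                                                            cong ind (ValidFixed-noSpecialCycle S x v w (suc i) j)))) ⟩
    0                                                  ≡⟨ *-zeroʳ (suc i) ⟨
    suc i * 0                                          ∎)
    where open ≡-Reasoning

  cycNumFixed-ordinary : S 1 ≡ true → ∀ m k t i j →
    suc j * cycNumFixed S (suc m) (suc k) t i (suc j) ≡ suc m * (k * cycNumFixed S m k t i j)
  cycNumFixed-ordinary S1 m k t i j =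
    trans (cycNumFixed-markOrdinary m k t i j)
          (trans (sum-cong-≗ (λ x → trans (∑ᵥ-cong m m (λ v → trans
                   (sum-cong-≗ (λ d → ∑ᵥ-cong k m (λ w → cong ind (ValidFixed-removeOrdinary S x v d w S1 t i j))))
                   (∑-const k _)))
                   (sym (*-distribˡ-∑ᵥ m m k _))))
                 (∑-const (suc m) _))

cycNum≡∑ᵥ : ∀ S m K t → cycNum S m K t ≡ ∑ᵥ m m (λ vσ → ∑ᵥ K m (λ vc → ind (validPair S m K t vσ vc)))
cycNum≡∑ᵥ S m K t = trans (∑ₗ-allVecs m m _)
  (∑ᵥ-cong m m (λ vσ → trans (count≡∑ₗ _ (allVecs K m)) (∑ₗ-allVecs K m _)))

cycNumFixed-noFixedPoint : ∀ S m K t → cycNumFixed S m K t 0 0 ≡ cycNum (without1 S) m K t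
cycNumFixed-noFixedPoint S m K t = sym (trans (cycNum≡∑ᵥ (without1 S) m K t)
  (∑ᵥ-cong m m (λ vσ → ∑ᵥ-cong K m (λ vc → cong ind (Valid-without1 S m K t (lookup vσ) (lookup vc))))))

∑-ind-≡ᵇ : ∀ n a → a ≤ n → ∑[ i < suc n ] ind (a ≡ᵇ toℕ i) ≡ 1
∑-ind-≡ᵇ n       zero    _         = cong suc (∑-zero n _ (λ _ → refl))
∑-ind-≡ᵇ (suc n) (suc a) (s≤s a≤n) = ∑-ind-≡ᵇ n a a≤n

specialFixed≤ : ∀ m {k} (σ : Fin m → Fin m) (c : Fin m → Fin k) → specialFixed m σ c ≤ m
specialFixed≤ m σ c = subst (_≤ m) (sym (count≡∑ m _)) (∑-ind≤ m (λ z → (σ z == z) ∧ (toℕ (c z) ≡ᵇ 0)))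

ordinaryFixed≤ : ∀ m {k} (σ : Fin m → Fin m) (c : Fin m → Fin k) → ordinaryFixed m σ c ≤ m
ordinaryFixed≤ m σ c = subst (_≤ m) (sym (count≡∑ m _)) (∑-ind≤ m (λ z → (σ z == z) ∧ not (toℕ (c z) ≡ᵇ 0)))

cycNum-byFixedPoints : ∀ S m K t →
  cycNum S m K t ≡ ∑[ i < suc m ] ∑[ j < suc m ] cycNumFixed S m K t (toℕ i) (toℕ j)
cycNum-byFixedPoints S m K t = begin
  cycNum S m K t
    ≡⟨ cycNum≡∑ᵥ S m K t ⟩
  ∑ᵥ m m (λ vσ → ∑ᵥ K m (λ vc → ind (validPair S m K t vσ vc)))
    ≡⟨ ∑ᵥ-cong m m (λ vσ → ∑ᵥ-cong K m (λ vc → split vσ vc)) ⟩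
  ∑ᵥ m m (λ vσ → ∑ᵥ K m (λ vc → ∑[ i < suc m ] ∑[ j < suc m ] W i j vσ vc))
    ≡⟨ ∑ᵥ-cong m m (λ vσ → ∑ᵥ-comm-∑ K m (suc m) (λ vc i → ∑[ j < suc m ] W i j vσ vc)) ⟩
  ∑ᵥ m m (λ vσ → ∑[ i < suc m ] ∑ᵥ K m (λ vc → ∑[ j < suc m ] W i j vσ vc))
    ≡⟨ ∑ᵥ-comm-∑ m m (suc m) (λ vσ i → ∑ᵥ K m (λ vc → ∑[ j < suc m ] W i j vσ vc)) ⟩
  ∑[ i < suc m ] ∑ᵥ m m (λ vσ → ∑ᵥ K m (λ vc → ∑[ j < suc m ] W i j vσ vc))
    ≡⟨ sum-cong-≗ (λ i → trans (∑ᵥ-cong m m (λ vσ → ∑ᵥ-comm-∑ K m (suc m) (λ vc j → W i j vσ vc)))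
                                (∑ᵥ-comm-∑ m m (suc m) (λ vσ j → ∑ᵥ K m (λ vc → W i j vσ vc)))) ⟩
  ∑[ i < suc m ] ∑[ j < suc m ] cycNumFixed S m K t (toℕ i) (toℕ j) ∎
  where
  open ≡-Reasoning
  W : Fin (suc m) → Fin (suc m) → Vec (Fin m) m → Vec (Fin K) m → ℕ
  W i j vσ vc = ind (ValidFixed S m K t (toℕ i) (toℕ j) vσ vc)
  split : ∀ vσ vc → ind (validPair S m K t vσ vc) ≡ ∑[ i < suc m ] ∑[ j < suc m ] W i j vσ vc
  split vσ vc = sym (begin
    ∑[ i < suc m ] ∑[ j < suc m ] W i j vσ vc
      ≡⟨ sum-cong-≗ {suc m} (λ i → sum-cong-≗ {suc m} (λ j → trans (ind-∧ v ((sf ≡ᵇ toℕ i) ∧ (of ≡ᵇ toℕ j))) (cong (ind v *_) (ind-∧ (sf ≡ᵇ toℕ i) (of ≡ᵇ toℕ j))))) ⟩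
    ∑[ i < suc m ] ∑[ j < suc m ] (ind v * (ind (sf ≡ᵇ toℕ i) * ind (of ≡ᵇ toℕ j)))
      ≡⟨ sum-cong-≗ {suc m} (λ i → trans (sym (*-distribˡ-sum {suc m} (ind v) (λ j → ind (sf ≡ᵇ toℕ i) * ind (of ≡ᵇ toℕ j))))
                                 (cong (ind v *_) (trans (sym (*-distribˡ-sum {suc m} (ind (sf ≡ᵇ toℕ i)) (λ j → ind (of ≡ᵇ toℕ j))))
                                                         (cong (ind (sf ≡ᵇ toℕ i) *_) (∑-ind-≡ᵇ m of (ordinaryFixed≤ m (lookup vσ) (lookup vc))))))) ⟩
    ∑[ i < suc m ] (ind v * (ind (sf ≡ᵇ toℕ i) * 1))
      ≡⟨ sym (*-distribˡ-sum {suc m} (ind v) (λ i → ind (sf ≡ᵇ toℕ i) * 1)) ⟩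
    ind v * ∑[ i < suc m ] (ind (sf ≡ᵇ toℕ i) * 1)
      ≡⟨ cong (ind v *_) (trans (sum-cong-≗ {suc m} (λ i → *-identityʳ (ind (sf ≡ᵇ toℕ i)))) (∑-ind-≡ᵇ m sf (specialFixed≤ m (lookup vσ) (lookup vc)))) ⟩
    ind v * 1
      ≡⟨ *-identityʳ (ind v) ⟩
    ind v ∎)
    where
    v  = validPair S m K t vσ vc
    sf = specialFixed m (lookup vσ) (lookup vc)
    of = ordinaryFixed m (lookup vσ) (lookup vc)

multinomDen : ℕ → ℕ → ℕ → ℕ
multinomDen m i j = i ! * j ! * (m ∸ i ∸ j) !

multinomDen≢0 : ∀ m i j → NonZero (multinomDen m i j)
multinomDen≢0 m i j =
  m*n≢0 (i ! * j !) ((m ∸ i ∸ j) !) {{m*n≢0 (i !) (j !) {{i !≢0}} {{j !≢0}}}} {{(m ∸ i ∸ j) !≢0}}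

multinomDen∣! : ∀ m i j → i + j ≤ m → multinomDen m i j ∣ m !
multinomDen∣! m i j i+j≤m =
  subst (_∣ m !) reorder (∣-trans (*-monoˡ-∣ (i !) ([n∸k]!k!∣n! j≤m∸i)) ([n∸k]!k!∣n! i≤m))
  where
  open +-*-Solver
  i≤m : i ≤ m
  i≤m = m+n≤o⇒m≤o i i+j≤m
  j≤m∸i : j ≤ m ∸ i
  j≤m∸i = m+n≤o⇒m≤o∸n j (subst (_≤ m) (+-comm i j) i+j≤m)
  reorder : (m ∸ i ∸ j) ! * j ! * i ! ≡ multinomDen m i j
  reorder = solve 3 (λ a b c → a :* b :* c := c :* b :* a) refl ((m ∸ i ∸ j) !) (j !) (i !)

multinom*multinomDen : ∀ m i j → i + j ≤ m → multinom m i j * multinomDen m i j ≡ m !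
multinom*multinomDen m i j i+j≤m rewrite ≤ᵇ-complete i+j≤m = m/n*n≡m {{multinomDen≢0 m i j}} (multinomDen∣! m i j i+j≤m)

multinom-> : ∀ m i j → m < i + j → multinom m i j ≡ 0
multinom-> m i j m<i+j rewrite ≤ᵇ-false m<i+j = refl

multinom-0-0 : ∀ m → multinom m 0 0 ≡ 1
multinom-0-0 m = *-cancelʳ-≡ (multinom m 0 0) 1 (m !) {{m !≢0}}
  (trans (cong (multinom m 0 0 *_) (sym (*-identityˡ (m !))))
         (trans (multinom*multinomDen m 0 0 z≤n) (sym (*-identityˡ (m !)))))

-- Both sides are compared after multiplying by the common denominator i! j! (m-i-j)!.
multinom-suc-i : ∀ m i j → suc i * multinom (suc m) (suc i) j ≡ suc m * multinom m i j
multinom-suc-i m i j with i + j ≤? m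
... | no  i+j≰m = trans (cong (suc i *_) (multinom-> (suc m) (suc i) j (s≤s (≰⇒> i+j≰m))))
                  (trans (*-zeroʳ (suc i)) (sym (trans (cong (suc m *_) (multinom-> m i j (≰⇒> i+j≰m))) (*-zeroʳ (suc m)))))
... | yes i+j≤m = *-cancelʳ-≡ _ _ (multinomDen m i j) {{multinomDen≢0 m i j}} (begin
  suc i * A * multinomDen m i j             ≡⟨ solve 5 (λ si a ifac jfac r → si :* a :* (ifac :* jfac :* r) := a :* (si :* ifac :* jfac :* r))
                                                     refl (suc i) A (i !) (j !) ((m ∸ i ∸ j) !) ⟩
  A * multinomDen (suc m) (suc i) j         ≡⟨ multinom*multinomDen (suc m) (suc i) j (s≤s i+j≤m) ⟩
  suc m * m !                               ≡⟨ cong (suc m *_) (multinom*multinomDen m i j i+j≤m) ⟨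
  suc m * (multinom m i j * multinomDen m i j) ≡⟨ *-assoc (suc m) (multinom m i j) (multinomDen m i j) ⟨
  suc m * multinom m i j * multinomDen m i j ∎)
  where
  open ≡-Reasoning
  open +-*-Solver
  A = multinom (suc m) (suc i) j

multinom-suc-j : ∀ m j → suc j * multinom (suc m) 0 (suc j) ≡ suc m * multinom m 0 j
multinom-suc-j m j with j ≤? m
... | no  j≰m = trans (cong (suc j *_) (multinom-> (suc m) 0 (suc j) (s≤s (≰⇒> j≰m))))
                (trans (*-zeroʳ (suc j)) (sym (trans (cong (suc m *_) (multinom-> m 0 j (≰⇒> j≰m))) (*-zeroʳ (suc m)))))
... | yes j≤m = *-cancelʳ-≡ _ _ (multinomDen m 0 j) {{multinomDen≢0 m 0 j}} (begin
  suc j * A * multinomDen m 0 j             ≡⟨ solve 4 (λ sj a jfac r → sj :* a :* (con 1 :* jfac :* r) := a :* (con 1 :* (sj :* jfac) :* r))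
                                                     refl (suc j) A (j !) ((m ∸ j) !) ⟩
  A * multinomDen (suc m) 0 (suc j)         ≡⟨ multinom*multinomDen (suc m) 0 (suc j) (s≤s j≤m) ⟩
  suc m * m !                               ≡⟨ cong (suc m *_) (multinom*multinomDen m 0 j j≤m) ⟨
  suc m * (multinom m 0 j * multinomDen m 0 j) ≡⟨ *-assoc (suc m) (multinom m 0 j) (multinomDen m 0 j) ⟨
  suc m * multinom m 0 j * multinomDen m 0 j ∎)
  where
  open ≡-Reasoning
  open +-*-Solver
  A = multinom (suc m) 0 (suc j)

fall-suc : ∀ k j → fall (suc k) (suc j) ≡ suc k * fall k j
fall-suc k zero    = trans (*-identityˡ (suc k)) (sym (*-identityʳ (suc k)))
fall-suc k (suc j) = trans (cong (_* (k ∸ j)) (fall-suc k j)) (*-assoc (suc k) (fall k j) (k ∸ j))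

fall-> : ∀ k j → k < j → fall k j ≡ 0
fall-> k (suc j) (s≤s k≤j) = trans (cong (fall k j *_) (m≤n⇒m∸n≡0 k≤j)) (*-zeroʳ (fall k j))

cycNumFixedFormula : (S : ℕ → Bool) (m k t i j : ℕ) → ℕ
cycNumFixedFormula S m k t i j =
  if i ≤ᵇ t then multinom m i j * fall k j * cycNum (without1 S) (m ∸ i ∸ j) (suc k ∸ j) (t ∸ i) else 0

module _ (S : ℕ → Bool) where

  private
    F = cycNumFixedFormula S
    N = cycNum (without1 S)

  formula-special : ∀ m k t i j → suc i * F (suc m) k (suc t) (suc i) j ≡ suc m * F m k t i j
  formula-special m k t i j with i ≤? t
  ... | no i≰t rewrite ≤ᵇ-false {suc i} {suc t} (s≤s (≰⇒> i≰t)) | ≤ᵇ-false (≰⇒> i≰t) =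
    trans (*-zeroʳ (suc i)) (sym (*-zeroʳ (suc m)))
  ... | yes i≤t rewrite ≤ᵇ-complete {suc i} {suc t} (s≤s i≤t) | ≤ᵇ-complete i≤t = begin
    suc i * (multinom (suc m) (suc i) j * fall k j * N (m ∸ i ∸ j) (suc k ∸ j) (t ∸ i))
      ≡⟨ solve 4 (λ a A f g → a :* (A :* f :* g) := a :* A :* (f :* g)) refl (suc i) (multinom (suc m) (suc i) j) (fall k j) (N (m ∸ i ∸ j) (suc k ∸ j) (t ∸ i)) ⟩
    suc i * multinom (suc m) (suc i) j * (fall k j * N (m ∸ i ∸ j) (suc k ∸ j) (t ∸ i))
      ≡⟨ cong (_* (fall k j * N (m ∸ i ∸ j) (suc k ∸ j) (t ∸ i))) (multinom-suc-i m i j) ⟩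
    suc m * multinom m i j * (fall k j * N (m ∸ i ∸ j) (suc k ∸ j) (t ∸ i))
      ≡⟨ solve 4 (λ a A f g → a :* A :* (f :* g) := a :* (A :* f :* g)) refl (suc m) (multinom m i j) (fall k j) (N (m ∸ i ∸ j) (suc k ∸ j) (t ∸ i)) ⟩
    suc m * (multinom m i j * fall k j * N (m ∸ i ∸ j) (suc k ∸ j) (t ∸ i)) ∎
    where
    open ≡-Reasoning
    open +-*-Solver

  formula-ordinary : ∀ m k t j → suc j * F (suc m) (suc k) t 0 (suc j) ≡ suc m * (suc k * F m k t 0 j)
  formula-ordinary m k t j = begin
    suc j * (multinom (suc m) 0 (suc j) * fall (suc k) (suc j) * N (m ∸ j) (suc k ∸ j) t)
      ≡⟨ cong (λ f → suc j * (multinom (suc m) 0 (suc j) * f * N (m ∸ j) (suc k ∸ j) t)) (fall-suc k j) ⟩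
    suc j * (multinom (suc m) 0 (suc j) * (suc k * fall k j) * N (m ∸ j) (suc k ∸ j) t)
      ≡⟨ solve 5 (λ a A K f g → a :* (A :* (K :* f) :* g) := a :* A :* (K :* f :* g)) refl (suc j) (multinom (suc m) 0 (suc j)) (suc k) (fall k j) (N (m ∸ j) (suc k ∸ j) t) ⟩
    suc j * multinom (suc m) 0 (suc j) * (suc k * fall k j * N (m ∸ j) (suc k ∸ j) t)
      ≡⟨ cong (_* (suc k * fall k j * N (m ∸ j) (suc k ∸ j) t)) (multinom-suc-j m j) ⟩
    suc m * multinom m 0 j * (suc k * fall k j * N (m ∸ j) (suc k ∸ j) t)
      ≡⟨ solve 5 (λ b B K f g → b :* B :* (K :* f :* g) := b :* (K :* (B :* f :* g))) refl (suc m) (multinom m 0 j) (suc k) (fall k j) (N (m ∸ j) (suc k ∸ j) t) ⟩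
    suc m * (suc k * (multinom m 0 j * fall k j * N (m ∸ j) (suc k ∸ j) t)) ∎
    where
    open ≡-Reasoning
    open +-*-Solver

  formula-multinom> : ∀ m k t i j → m < i + j → F m k t i j ≡ 0
  formula-multinom> m k t i j m<i+j with i ≤ᵇ t
  ... | false = refl
  ... | true rewrite multinom-> m i j m<i+j = refl

  formula-t< : ∀ m k t i j → t < i → F m k t i j ≡ 0
  formula-t< m k t i j t<i rewrite ≤ᵇ-false t<i = refl

  formula-fall> : ∀ m k t i j → k < j → F m k t i j ≡ 0
  formula-fall> m k t i j k<j with i ≤ᵇ t
  ... | false = refl
  ... | true rewrite fall-> k j k<j | *-zeroʳ (multinom m i j) = refl

  -- Induction on (i, j, m): removing a marked fixed point lowers m together with i or j.
  cycNumFixed≡formula : S 1 ≡ true → ∀ i j m k t → cycNumFixed S m (suc k) t i j ≡ F m k t i j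
  cycNumFixed≡formula S1 zero    zero    m       k       t =
    trans (cycNumFixed-noFixedPoint S m (suc k) t)
          (sym (trans (cong (λ a → a * 1 * N m (suc k) t) (multinom-0-0 m)) (+-identityʳ _)))
  cycNumFixed≡formula S1 zero    (suc j) zero    k       t =
    cong ind (∧-zeroʳ (validPair S 0 (suc k) t [] []))
  cycNumFixed≡formula S1 zero    (suc j) (suc m) zero    t = trans
    (*-cancelˡ-≡ _ 0 (suc j) (trans (cycNumFixed-ordinary S S1 m 0 t 0 j) (trans (*-zeroʳ (suc m)) (sym (*-zeroʳ (suc j))))))
    (sym (formula-fall> (suc m) 0 t 0 (suc j) (s≤s z≤n)))
  cycNumFixed≡formula S1 zero    (suc j) (suc m) (suc k) t = *-cancelˡ-≡ _ _ (suc j) (begin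
    suc j * cycNumFixed S (suc m) (suc (suc k)) t 0 (suc j) ≡⟨ cycNumFixed-ordinary S S1 m (suc k) t 0 j ⟩
    suc m * (suc k * cycNumFixed S m (suc k) t 0 j)         ≡⟨ cong (λ a → suc m * (suc k * a)) (cycNumFixed≡formula S1 0 j m k t) ⟩
    suc m * (suc k * F m k t 0 j)                           ≡⟨ formula-ordinary m k t j ⟨
    suc j * F (suc m) (suc k) t 0 (suc j)                   ∎)
    where open ≡-Reasoning
  cycNumFixed≡formula S1 (suc i) j       zero    k       t =
    trans (cong ind (∧-zeroʳ (validPair S 0 (suc k) t [] []))) (sym (formula-multinom> 0 k t (suc i) j (s≤s z≤n)))
  cycNumFixed≡formula S1 (suc i) j       (suc m) k       zero = cycNumFixed-noSpecialCycle S m k i j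
  cycNumFixed≡formula S1 (suc i) j       (suc m) k  (suc t) = *-cancelˡ-≡ _ _ (suc i) (begin
    suc i * cycNumFixed S (suc m) (suc k) (suc t) (suc i) j ≡⟨ cycNumFixed-special S S1 m k t i j ⟩
    suc m * cycNumFixed S m (suc k) t i j                   ≡⟨ cong (suc m *_) (cycNumFixed≡formula S1 i j m k t) ⟩
    suc m * F m k t i j                                     ≡⟨ formula-special m k t i j ⟨
    suc i * F (suc m) k (suc t) (suc i) j                   ∎)
    where open ≡-Reasoning

sum-applyUpTo : ∀ n (h : ℕ → ℕ) → sum (applyUpTo h n) ≡ ∑[ i < n ] h (toℕ i)
sum-applyUpTo zero    h = refl
sum-applyUpTo (suc n) h = cong (h 0 +_) (sum-applyUpTo n (h ∘ suc))

sumTo≡∑ : ∀ t f → sumTo t f ≡ ∑[ i < suc t ] f (toℕ i)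
sumTo≡∑ t f = trans (cong sum (List.map-upTo f (suc t))) (sum-applyUpTo (suc t) f)

∑-extend : ∀ n d (h : ℕ → ℕ) → (∀ i → n ≤ i → h i ≡ 0) → ∑[ i < n + d ] h (toℕ i) ≡ ∑[ i < n ] h (toℕ i)
∑-extend zero    d h vanish = ∑-zero d _ (λ i → vanish (toℕ i) z≤n)
∑-extend (suc n) d h vanish = cong (h 0 +_) (∑-extend n d (h ∘ suc) (λ i n≤i → vanish (suc i) (s≤s n≤i)))

∑-support : ∀ a b (h : ℕ → ℕ) → (∀ i → a ≤ i → h i ≡ 0) → (∀ i → b ≤ i → h i ≡ 0) →
  ∑[ i < a ] h (toℕ i) ≡ ∑[ i < b ] h (toℕ i)
∑-support a b h vanish-a vanish-b = begin
  ∑[ i < a ] h (toℕ i)     ≡⟨ ∑-extend a b h vanish-a ⟨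
  ∑[ i < a + b ] h (toℕ i) ≡⟨ cong (λ n → ∑[ i < n ] h (toℕ i)) (+-comm a b) ⟩
  ∑[ i < b + a ] h (toℕ i) ≡⟨ ∑-extend b a h vanish-b ⟩
  ∑[ i < b ] h (toℕ i)     ∎
  where open ≡-Reasoning

-- The formula vanishes unless i ≤ t + 1, j ≤ k and i + j ≤ n + 1.
∑-formula : ∀ S n k t →
  ∑[ i < suc (suc n) ] ∑[ j < suc (suc n) ] cycNumFixedFormula S (suc n) k (suc t) (toℕ i) (toℕ j)
    ≡ sumTo (suc t) (λ i → sumTo k (λ j →
        multinom (suc n) i j * fall k j * cycNum (without1 S) (suc n ∸ i ∸ j) (suc k ∸ j) (suc t ∸ i)))
∑-formula S n k t = begin
  ∑[ i < suc (suc n) ] ∑[ j < suc (suc n) ] F (toℕ i) (toℕ j)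
    ≡⟨ sum-cong-≗ {suc (suc n)} (λ i → ∑-support (suc (suc n)) (suc k) (F (toℕ i))
                            (λ j n<j → formula-multinom> S (suc n) k (suc t) (toℕ i) j (<-≤-trans n<j (m≤n+m j (toℕ i))))
                            (λ j k<j → formula-fall> S (suc n) k (suc t) (toℕ i) j k<j)) ⟩
  ∑[ i < suc (suc n) ] ∑[ j < suc k ] F (toℕ i) (toℕ j)
    ≡⟨ ∑-support (suc (suc n)) (suc (suc t)) (λ i → ∑[ j < suc k ] F i (toℕ j))
         (λ i n<i → ∑-zero (suc k) _ (λ j → formula-multinom> S (suc n) k (suc t) i (toℕ j) (<-≤-trans n<i (m≤m+n i (toℕ j)))))
         (λ i t<i → ∑-zero (suc k) _ (λ j → formula-t< S (suc n) k (suc t) i (toℕ j) t<i)) ⟩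
  ∑[ i < suc (suc t) ] ∑[ j < suc k ] F (toℕ i) (toℕ j)
    ≡⟨ sum-cong-≗ {suc (suc t)} (λ i → sum-cong-≗ {suc k} (λ j → cong (λ b → if b then X (toℕ i) (toℕ j) else 0)
                                                                       (≤ᵇ-complete (≤-pred (Fin.toℕ<n i))))) ⟩
  ∑[ i < suc (suc t) ] ∑[ j < suc k ] X (toℕ i) (toℕ j)
    ≡⟨ sym (trans (sumTo≡∑ (suc t) (λ i → sumTo k (X i))) (sum-cong-≗ {suc (suc t)} (λ i → sumTo≡∑ k (X (toℕ i))))) ⟩
  sumTo (suc t) (λ i → sumTo k (X i)) ∎
  where
  open ≡-Reasoning
  F = cycNumFixedFormula S (suc n) k (suc t)
  X : ℕ → ℕ → ℕ
  X i j = multinom (suc n) i j * fall k j * cycNum (without1 S) (suc n ∸ i ∸ j) (suc k ∸ j) (suc t ∸ i)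

mainTheorem15 : (S : ℕ → Bool) → S 1 ≡ true → (n k t : ℕ) →
    cycNum S (suc n) (suc k) (suc t) ≡
      sumTo (suc t) (λ i → sumTo k (λ j →
        multinom (suc n) i j * fall k j
          * cycNum (without1 S) (suc n ∸ i ∸ j) (suc k ∸ j) (suc t ∸ i)))
mainTheorem15 S S1 n k t = begin
  cycNum S (suc n) (suc k) (suc t)
    ≡⟨ cycNum-byFixedPoints S (suc n) (suc k) (suc t) ⟩
  ∑[ i < suc (suc n) ] ∑[ j < suc (suc n) ] cycNumFixed S (suc n) (suc k) (suc t) (toℕ i) (toℕ j)
    ≡⟨ sum-cong-≗ {suc (suc n)} (λ i → sum-cong-≗ {suc (suc n)} (λ j → cycNumFixed≡formula S S1 (toℕ i) (toℕ j) (suc n) k (suc t))) ⟩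
  ∑[ i < suc (suc n) ] ∑[ j < suc (suc n) ] cycNumFixedFormula S (suc n) k (suc t) (toℕ i) (toℕ j)
    ≡⟨ ∑-formula S n k t ⟩
  _ ∎
  where open ≡-Reasoning
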